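{- Let $m\ge1$, $k\ge1$ and $h\le k-1$ be integers. The generating function for the number of partitions $\lambda$ of $n$ with an $h$-fixed hook in the $m$th column that arises from a hook of size $k$ (i.e. the row $s=k-h$ satisfies $\lambda_s\ge m$ and $h_{s,m}(\lambda)=k=s+h$) is \[ \sum_{l=1}^{k}\frac{q^{(m-1)(2k-h-l)+k+l(k-h-1)}}{(q;q)_{k-h-1}(q;q)_{m-1}}\binom{k-1}{l-1}_q . \]
   Context: For a partition $\lambda$ with conjugate $\lambda'$, $h_{i,j}(\lambda)=\lambda_i+\lambda'_j-i-j+1$ is the hook length of cell $(i,j)$, $j\le\lambda_i$. An $h$-fixed hook in the $m$th column is a row $i$ with $\lambda_i\ge m$ and $h_{i,m}(\lambda)=i+h$. Notation: $(a;b)_n=\prod_{t=0}^{n-1}(1-ab^t)$, $\binom{a}{b}_q=\frac{(q;q)_a}{(q;q)_b(q;q)_{a-b}}$. -}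

module Defs where

open import Data.Bool using (Bool; true; false; _∧_; T)
open import Data.Nat as ℕ using (ℕ; zero; suc; _∸_; _≤ᵇ_; _≡ᵇ_)
open import Data.Integer as ℤ using (ℤ; +_; -_; ∣_∣)
open import Data.List using (List; []; _∷_; length; filter; map; zipWith; upTo; foldr)
open import Data.Nat.ListAction using (sum)
open import Relation.Nullary.Decidable using (⌊_⌋)
open import Data.Product using (Σ)
open import Function.Bundles using (_↔_)
open import Data.Fin using (Fin)

decreasingᵇ : List ℕ → Bool
decreasingᵇ [] = true
decreasingᵇ (x ∷ []) = true
decreasingᵇ (x ∷ y ∷ l) = (y ≤ᵇ x) ∧ decreasingᵇ (y ∷ l)

positiveᵇ : List ℕ → Bool
positiveᵇ [] = true
positiveᵇ (x ∷ l) = (1 ≤ᵇ x) ∧ positiveᵇ l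

isPartitionOfᵇ : ℕ → List ℕ → Bool
isPartitionOfᵇ n λs = decreasingᵇ λs ∧ positiveᵇ λs ∧ (sum λs ≡ᵇ n)

-- λ_i, 1-indexed, with λ_i = 0 beyond the length
part : List ℕ → ℕ → ℕ
part [] i = 0
part (x ∷ l) zero = 0            -- index 0 is not used
part (x ∷ l) (suc zero) = x
part (x ∷ l) (suc (suc i)) = part l (suc i)

conj : List ℕ → ℕ → ℕ
conj λs j = length (filter (λ x → j ℕ.≤? x) λs)

-- hook length h_{i,j}(λ) = λ_i + λ'_j - i - j + 1 (for j ≤ λ_i, where it is ≥ 1)
hook : List ℕ → ℕ → ℕ → ℕ
hook λs i j = ∣ (+ part λs i) ℤ.+ (+ conj λs j) ℤ.- (+ i) ℤ.- (+ j) ℤ.+ (+ 1) ∣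

-- λ has an h-fixed hook in the m-th column arising from a hook of size k:
-- the row s = k - h satisfies λ_s ≥ m and h_{s,m}(λ) = k.
-- (s is passed as a natural number; the theorem instantiates s = k - h.)
fixedHookᵇ : ℕ → ℕ → ℕ → List ℕ → Bool
fixedHookᵇ m k s λs = (m ≤ᵇ part λs s) ∧ (hook λs s m ≡ᵇ k)

HookPartitions : ℕ → ℕ → ℕ → ℕ → Set
HookPartitions m k s n = Σ (List ℕ) (λ λs → T (isPartitionOfᵇ n λs ∧ fixedHookᵇ m k s λs))

Series : Set
Series = ℕ → ℤ

sumTo : ℕ → (ℕ → ℤ) → ℤ
sumTo zero f = f 0
sumTo (suc n) f = sumTo n f ℤ.+ f (suc n)

_⊕_ : Series → Series → Series
(f ⊕ g) n = f n ℤ.+ g n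

_⊛_ : Series → Series → Series
(f ⊛ g) n = sumTo n (λ i → f i ℤ.* g (n ∸ i))

one : Series
one zero = + 1
one (suc n) = + 0

qPow : ℕ → Series
qPow e n = if′ (e ℕ.≡ᵇ n)
  where
  if′ : Bool → ℤ
  if′ true = + 1
  if′ false = + 0

qPoch : ℕ → Series
qPoch zero = one
qPoch (suc n) = qPoch n ⊛ (λ i → one i ℤ.- qPow (suc n) i)

-- Multiplicative inverse of a series f with f 0 = 1:
-- c_0 = 1, c_{n+1} = - Σ_{i=1}^{n+1} f i * c_{n+1-i}.
-- invRev f n = [c_n, …, c_0].
private
  nextCoeff : Series → List ℤ → ℤ
  nextCoeff f rev = - foldr ℤ._+_ (+ 0) (zipWith (λ j c → f (suc j) ℤ.* c) (upTo (length rev)) rev)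

invRev : Series → ℕ → List ℤ
invRev f zero = + 1 ∷ []
invRev f (suc n) = let r = invRev f n in nextCoeff f r ∷ r

inv : Series → Series
inv f n = headOr (invRev f n)
  where
  headOr : List ℤ → ℤ
  headOr [] = + 0
  headOr (x ∷ _) = x

qBinom : ℕ → ℕ → Series
qBinom a b = qPoch a ⊛ inv (qPoch b ⊛ qPoch (a ∸ b))

sumSeries1 : ℕ → (ℕ → Series) → Series
sumSeries1 zero F = λ _ → + 0
sumSeries1 (suc k) F = sumSeries1 k F ⊕ F (suc k)

hookGF : ℕ → ℕ → ℤ → Series
hookGF m k h = sumSeries1 k term
  where
  m' k' : ℤ
  m' = + m
  k' = + k
  term : ℕ → Series
  term l = (qPow ∣ (m' ℤ.- + 1) ℤ.* (+ 2 ℤ.* k' ℤ.- h ℤ.- + l) ℤ.+ k' ℤ.+ (+ l) ℤ.* (k' ℤ.- h ℤ.- + 1) ∣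
             ⊛ inv (qPoch ∣ k' ℤ.- h ℤ.- + 1 ∣ ⊛ qPoch (m ∸ 1)))
           ⊛ qBinom (k ∸ 1) (l ∸ 1)

-- With arm a = λ_s − m
-- and leg L = k − 1 − a, λ is determined by a ∈ [0, k − 1] and three independent pieces:
--   the first s − 1 rows, lowered by λ_s: a decreasing sequence of s − 1 naturals, counted by 1/(q;q)_{s−1};
--   the L rows below s that reach column m, lowered by m: L entries in [0, a], counted by [k−1 choose a]_q;
--   the remaining rows, all shorter than m: a partition with parts < m, counted by 1/(q;q)_{m−1};
-- on top of a frame of s rows of length m + a and L rows of length m, of size s(m + a) + Lm, which is
-- the exponent of the theorem for l = a + 1. Each of the three generating functions is recognised from a
-- bijective recurrence: F_n = F_{n−1} + q^n F_n forces F_n = 1/(q;q)_n, and the q-Pascal rule forces the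
-- Gaussian binomial.

module Submission where

open import Defs
open import Algebra.Bundles using (CommutativeRing)
import Algebra.Solver.Ring.AlmostCommutativeRing as ACR
open import Data.Bool using (Bool; T; _∧_)
import Data.Bool.Properties as BoolP
open import Data.Empty using (⊥-elim)
open import Data.Fin as Fin using (Fin)
import Data.Fin.Properties as FP
open import Data.Integer as ℤ using (ℤ; +_; -_; ∣_∣)
import Data.Integer.Properties as ℤP
import Data.Integer.Tactic.RingSolver as Z
open import Data.List using (List; []; _∷_; length; map; _++_; _∷ʳ_; replicate; filter; zipWith; upTo; applyUpTo; foldr)
import Data.List.Properties as LP
open import Data.List.Relation.Unary.All as All using (All; []; _∷_; all?)
import Data.List.Relation.Unary.All.Properties as AllP
open import Data.Maybe using (just; nothing)
open import Data.Nat as ℕ using (ℕ; zero; suc; _∸_; z≤n; s≤s; _≤_)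
open import Data.Nat.Induction using (<-rec)
open import Data.Nat.ListAction using (sum)
import Data.Nat.ListAction.Properties as ΣP
import Data.Nat.Properties as ℕP
open import Data.Nat.Tactic.RingSolver using (solve-∀)
open import Data.Product using (Σ; _×_; _,_; proj₁; proj₂)
open import Data.Product.Function.Dependent.Propositional using (Σ-↔)
open import Data.Product.Function.NonDependent.Propositional using (_×-↔_)
open import Data.Sum using (_⊎_; inj₁; inj₂)
open import Data.Sum.Function.Propositional using (_⊎-↔_)
open import Data.Unit using (⊤; tt)
open import Function.Bundles using (_↔_; mk↔ₛ′; Injection; Equivalence)
open import Function.Properties.Inverse using (↔-refl; ↔-sym; ↔-trans; ↔⇒↣)
open import Relation.Binary.Definitions using (WeaklyDecidable)
open import Relation.Binary.PropositionalEquality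
open import Relation.Nullary using (¬_; Dec; yes; no)
open import Relation.Unary using (Irrelevant; _⟨×⟩_)

-- Finite sums

module _ where
  open import Data.Integer using (_+_; _*_)
  open import Algebra.Properties.CommutativeSemigroup ℤP.+-commutativeSemigroup using (interchange)
  open ≡-Reasoning

  sumTo-cong : ∀ n {f g : ℕ → ℤ} → (∀ i → i ℕ.≤ n → f i ≡ g i) → sumTo n f ≡ sumTo n g
  sumTo-cong zero f≡g = f≡g 0 z≤n
  sumTo-cong (suc n) f≡g =
    cong₂ _+_ (sumTo-cong n (λ i i≤n → f≡g i (ℕP.m≤n⇒m≤1+n i≤n))) (f≡g (suc n) ℕP.≤-refl)

  sumTo-+ : ∀ n (f g : ℕ → ℤ) → sumTo n (λ i → f i + g i) ≡ sumTo n f + sumTo n g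
  sumTo-+ zero f g = refl
  sumTo-+ (suc n) f g =
    trans (cong (_+ (f (suc n) + g (suc n))) (sumTo-+ n f g)) (interchange (sumTo n f) (sumTo n g) (f (suc n)) (g (suc n)))

  sumTo-*ˡ : ∀ n c (f : ℕ → ℤ) → sumTo n (λ i → c * f i) ≡ c * sumTo n f
  sumTo-*ˡ zero c f = refl
  sumTo-*ˡ (suc n) c f =
    trans (cong (_+ c * f (suc n)) (sumTo-*ˡ n c f)) (sym (ℤP.*-distribˡ-+ c (sumTo n f) (f (suc n))))

  sumTo-*ʳ : ∀ n c (f : ℕ → ℤ) → sumTo n (λ i → f i * c) ≡ sumTo n f * c
  sumTo-*ʳ zero c f = refl
  sumTo-*ʳ (suc n) c f =
    trans (cong (_+ f (suc n) * c) (sumTo-*ʳ n c f)) (sym (ℤP.*-distribʳ-+ c (sumTo n f) (f (suc n))))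

  sumTo-zero : ∀ n → sumTo n (λ _ → + 0) ≡ + 0
  sumTo-zero zero = refl
  sumTo-zero (suc n) = cong (_+ + 0) (sumTo-zero n)

  sumTo-sucˡ : ∀ n (f : ℕ → ℤ) → sumTo (suc n) f ≡ f 0 + sumTo n (λ i → f (suc i))
  sumTo-sucˡ zero f = refl
  sumTo-sucˡ (suc n) f =
    trans (cong (_+ f (suc (suc n))) (sumTo-sucˡ n f)) (ℤP.+-assoc (f 0) _ _)

  sumTo-reverse : ∀ n (f : ℕ → ℤ) → sumTo n f ≡ sumTo n (λ i → f (n ∸ i))
  sumTo-reverse zero f = refl
  sumTo-reverse (suc n) f = begin
    sumTo n f + f (suc n)                    ≡⟨ cong (_+ f (suc n)) (sumTo-reverse n f) ⟩
    sumTo n (λ i → f (n ∸ i)) + f (suc n)    ≡⟨ ℤP.+-comm _ (f (suc n)) ⟩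
    f (suc n) + sumTo n (λ i → f (n ∸ i))    ≡⟨ sumTo-sucˡ n (λ i → f (suc n ∸ i)) ⟨
    sumTo (suc n) (λ i → f (suc n ∸ i))      ∎

  sumTo-triangle : ∀ n (F : ℕ → ℕ → ℤ) →
    sumTo n (λ i → sumTo i (F i)) ≡ sumTo n (λ j → sumTo (n ∸ j) (λ t → F (j ℕ.+ t) j))
  sumTo-triangle zero F = refl
  sumTo-triangle (suc n) F = begin
    sumTo n (λ i → sumTo i (F i)) + sumTo (suc n) (F (suc n))
      ≡⟨ cong (_+ sumTo (suc n) (F (suc n))) (sumTo-triangle n F) ⟩
    sumTo n (column n) + (sumTo n (F (suc n)) + F (suc n) (suc n))
      ≡⟨ ℤP.+-assoc (sumTo n (column n)) _ _ ⟨
    (sumTo n (column n) + sumTo n (F (suc n))) + F (suc n) (suc n)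
      ≡⟨ cong₂ _+_ (sym (sumTo-+ n (column n) (F (suc n)))) (sym lastColumn) ⟩
    sumTo n (λ j → column n j + F (suc n) j) + column (suc n) (suc n)
      ≡⟨ cong (_+ column (suc n) (suc n)) (sumTo-cong n (λ j j≤n → sym (column-suc j j≤n))) ⟩
    sumTo n (column (suc n)) + column (suc n) (suc n)
      ∎
    where
    column : ℕ → ℕ → ℤ
    column n j = sumTo (n ∸ j) (λ t → F (j ℕ.+ t) j)
    lastColumn : column (suc n) (suc n) ≡ F (suc n) (suc n)
    lastColumn rewrite ℕP.n∸n≡0 n | ℕP.+-identityʳ n = refl
    column-suc : ∀ j → j ℕ.≤ n → column (suc n) j ≡ column n j + F (suc n) j
    column-suc j j≤n rewrite ℕP.+-∸-assoc 1 j≤n | ℕP.+-suc j (n ∸ j) | ℕP.m+[n∸m]≡n j≤n = refl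

-- The ring of formal power series

module _ where
  open import Data.Integer using (_+_; _*_; _-_)
  open ≡-Reasoning

  0ₛ : Series
  0ₛ _ = + 0

  -ₛ_ : Series → Series
  (-ₛ f) n = - f n

  _⊖_ : Series → Series → Series
  (f ⊖ g) n = f n - g n

  ⊛-cong : ∀ {f f′ g g′} → f ≗ f′ → g ≗ g′ → (f ⊛ g) ≗ (f′ ⊛ g′)
  ⊛-cong f≗f′ g≗g′ n = sumTo-cong n (λ i _ → cong₂ _*_ (f≗f′ i) (g≗g′ (n ∸ i)))

  ⊛-congˡ : ∀ f {g g′} → g ≗ g′ → (f ⊛ g) ≗ (f ⊛ g′)
  ⊛-congˡ f = ⊛-cong {f} {f} (λ _ → refl)

  ⊛-congʳ : ∀ h {f f′} → f ≗ f′ → (f ⊛ h) ≗ (f′ ⊛ h)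
  ⊛-congʳ h f≗f′ = ⊛-cong {g = h} {h} f≗f′ (λ _ → refl)

  ⊛-comm : ∀ f g → (f ⊛ g) ≗ (g ⊛ f)
  ⊛-comm f g n = trans (sumTo-reverse n _) (sumTo-cong n λ i i≤n →
    trans (cong (λ j → f (n ∸ i) * g j) (ℕP.m∸[m∸n]≡n i≤n)) (ℤP.*-comm (f (n ∸ i)) (g i)))

  ⊛-assoc : ∀ f g h → ((f ⊛ g) ⊛ h) ≗ (f ⊛ (g ⊛ h))
  ⊛-assoc f g h n = begin
    sumTo n (λ i → sumTo i (λ j → f j * g (i ∸ j)) * h (n ∸ i))
      ≡⟨ sumTo-cong n (λ i _ → sumTo-*ʳ i (h (n ∸ i)) _) ⟨
    sumTo n (λ i → sumTo i (λ j → f j * g (i ∸ j) * h (n ∸ i)))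
      ≡⟨ sumTo-triangle n (λ i j → f j * g (i ∸ j) * h (n ∸ i)) ⟩
    sumTo n (λ j → sumTo (n ∸ j) (λ t → f j * g (j ℕ.+ t ∸ j) * h (n ∸ (j ℕ.+ t))))
      ≡⟨ sumTo-cong n (λ j _ → sumTo-cong (n ∸ j) (λ t _ → regroup j t)) ⟩
    sumTo n (λ j → sumTo (n ∸ j) (λ t → f j * (g t * h (n ∸ j ∸ t))))
      ≡⟨ sumTo-cong n (λ j _ → sumTo-*ˡ (n ∸ j) (f j) _) ⟩
    sumTo n (λ j → f j * sumTo (n ∸ j) (λ t → g t * h (n ∸ j ∸ t)))
      ∎
    where
    regroup : ∀ j t → f j * g (j ℕ.+ t ∸ j) * h (n ∸ (j ℕ.+ t)) ≡ f j * (g t * h (n ∸ j ∸ t))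
    regroup j t rewrite ℕP.m+n∸m≡n j t | ℕP.∸-+-assoc n j t = ℤP.*-assoc (f j) (g t) _

  ⊛-identityˡ : ∀ f → (one ⊛ f) ≗ f
  ⊛-identityˡ f zero = ℤP.*-identityˡ (f 0)
  ⊛-identityˡ f (suc n) = begin
    sumTo (suc n) (λ i → one i * f (suc n ∸ i))
      ≡⟨ sumTo-sucˡ n _ ⟩
    + 1 * f (suc n) + sumTo n (λ i → + 0 * f (n ∸ i))
      ≡⟨ cong₂ _+_ (ℤP.*-identityˡ (f (suc n))) (sumTo-cong n (λ i _ → ℤP.*-zeroˡ (f (n ∸ i)))) ⟩
    f (suc n) + sumTo n (λ _ → + 0)
      ≡⟨ cong (λ s → f (suc n) + s) (sumTo-zero n) ⟩
    f (suc n) + + 0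
      ≡⟨ ℤP.+-identityʳ (f (suc n)) ⟩
    f (suc n)
      ∎

  ⊛-identityʳ : ∀ f → (f ⊛ one) ≗ f
  ⊛-identityʳ f n = trans (⊛-comm f one n) (⊛-identityˡ f n)

  ⊛-distribˡ-⊕ : ∀ f g h → (f ⊛ (g ⊕ h)) ≗ ((f ⊛ g) ⊕ (f ⊛ h))
  ⊛-distribˡ-⊕ f g h n =
    trans (sumTo-cong n (λ i _ → ℤP.*-distribˡ-+ (f i) (g (n ∸ i)) (h (n ∸ i)))) (sumTo-+ n _ _)

  ⊛-distribʳ-⊕ : ∀ f g h → ((g ⊕ h) ⊛ f) ≗ ((g ⊛ f) ⊕ (h ⊛ f))
  ⊛-distribʳ-⊕ f g h n = begin
    ((g ⊕ h) ⊛ f) n           ≡⟨ ⊛-comm (g ⊕ h) f n ⟩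
    (f ⊛ (g ⊕ h)) n           ≡⟨ ⊛-distribˡ-⊕ f g h n ⟩
    (f ⊛ g) n + (f ⊛ h) n     ≡⟨ cong₂ _+_ (⊛-comm f g n) (⊛-comm f h n) ⟩
    (g ⊛ f) n + (h ⊛ f) n     ∎

Series-commutativeRing : CommutativeRing _ _
Series-commutativeRing = record
  { Carrier = Series
  ; _≈_ = _≗_
  ; _+_ = _⊕_
  ; _*_ = _⊛_
  ; -_ = -ₛ_
  ; 0# = 0ₛ
  ; 1# = one
  ; isCommutativeRing = record
    { isRing = record
      { +-isAbelianGroup = Pointwise.isAbelianGroup ℤP.+-0-isAbelianGroup
      ; *-cong = ⊛-cong
      ; *-assoc = ⊛-assoc
      ; *-identity = ⊛-identityˡ , ⊛-identityʳ
      ; distrib = ⊛-distribˡ-⊕ , ⊛-distribʳ-⊕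
      }
    ; *-comm = ⊛-comm
    }
  }
  where import Algebra.Construct.Pointwise ℕ as Pointwise

scalar : ℤ → Series
scalar c zero = c
scalar c (suc n) = + 0

scalar-*-homo : ∀ a b → scalar (a ℤ.* b) ≗ (scalar a ⊛ scalar b)
scalar-*-homo a b zero = refl
scalar-*-homo a b (suc n) = sym (begin
  sumTo (suc n) (λ i → scalar a i ℤ.* scalar b (suc n ∸ i))
    ≡⟨ sumTo-sucˡ n _ ⟩
  a ℤ.* + 0 ℤ.+ sumTo n (λ i → + 0 ℤ.* scalar b (n ∸ i))
    ≡⟨ cong₂ ℤ._+_ (ℤP.*-zeroʳ a) (sumTo-cong n (λ i _ → ℤP.*-zeroˡ (scalar b (n ∸ i)))) ⟩
  + 0 ℤ.+ sumTo n (λ _ → + 0)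
    ≡⟨ trans (ℤP.+-identityˡ _) (sumTo-zero n) ⟩
  + 0
    ∎)
  where open ≡-Reasoning

scalar-homomorphism : ℤ.+-*-rawRing ACR.-Raw-AlmostCommutative⟶ ACR.fromCommutativeRing Series-commutativeRing
scalar-homomorphism = record
  { ⟦_⟧ = scalar
  ; +-homo = λ { a b zero → refl ; a b (suc n) → refl }
  ; *-homo = scalar-*-homo
  ; -‿homo = λ { a zero → refl ; a (suc n) → refl }
  ; 0-homo = λ { zero → refl ; (suc n) → refl }
  ; 1-homo = λ { zero → refl ; (suc n) → refl }
  }

scalar-≟ : WeaklyDecidable (λ a b → scalar a ≗ scalar b)
scalar-≟ a b with a ℤ.≟ b
... | yes refl = just (λ _ → refl)
... | no _ = nothing

open import Algebra.Solver.Ring ℤ.+-*-rawRing (ACR.fromCommutativeRing Series-commutativeRing) scalar-homomorphism scalar-≟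
  using (solve; _:=_; _:+_; _:*_; _:-_)

private module S = CommutativeRing Series-commutativeRing

-- Monomials, inverses and q-Pochhammer symbols

qPow-zero : qPow 0 ≗ one
qPow-zero zero = refl
qPow-zero (suc n) = refl

qPow-suc-⊛ : ∀ e f N → (qPow (suc e) ⊛ f) (suc N) ≡ (qPow e ⊛ f) N
qPow-suc-⊛ e f N = trans (sumTo-sucˡ N _) (ℤP.+-identityˡ _)

qPow-⊛-≤ : ∀ e f N → e ℕ.≤ N → (qPow e ⊛ f) N ≡ f (N ∸ e)
qPow-⊛-≤ zero f N _ = trans (⊛-congʳ f qPow-zero N) (⊛-identityˡ f N)
qPow-⊛-≤ (suc e) f (suc N) (s≤s e≤N) = trans (qPow-suc-⊛ e f N) (qPow-⊛-≤ e f N e≤N)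

qPow-⊛-< : ∀ e f N → N ℕ.< e → (qPow e ⊛ f) N ≡ + 0
qPow-⊛-< (suc e) f zero _ = refl
qPow-⊛-< (suc e) f (suc N) (s≤s N<e) = trans (qPow-suc-⊛ e f N) (qPow-⊛-< e f N N<e)

qPow-+ : ∀ a b → (qPow a ⊛ qPow b) ≗ qPow (a ℕ.+ b)
qPow-+ zero b N = trans (⊛-congʳ (qPow b) qPow-zero N) (⊛-identityˡ (qPow b) N)
qPow-+ (suc a) b zero = refl
qPow-+ (suc a) b (suc N) = trans (qPow-suc-⊛ a (qPow b) N) (qPow-+ a b N)

module _ where
  open import Data.Integer using (_+_; _*_)
  open ≡-Reasoning

  private
    coefficientsDown : (ℕ → ℤ) → ℕ → List ℤ
    coefficientsDown c zero = c 0 ∷ []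
    coefficientsDown c (suc n) = c (suc n) ∷ coefficientsDown c n

    invRev≡coefficientsDown : ∀ f n → invRev f n ≡ coefficientsDown (inv f) n
    invRev≡coefficientsDown f zero = refl
    invRev≡coefficientsDown f (suc n) = cong (inv f (suc n) ∷_) (invRev≡coefficientsDown f n)

    length-coefficientsDown : ∀ c n → length (coefficientsDown c n) ≡ suc n
    length-coefficientsDown c zero = refl
    length-coefficientsDown c (suc n) = cong suc (length-coefficientsDown c n)

    foldr-zipWith-coefficientsDown : ∀ (G : ℕ → ℤ → ℤ) φ c n →
      foldr _+_ (+ 0) (zipWith G (applyUpTo φ (suc n)) (coefficientsDown c n)) ≡ sumTo n (λ j → G (φ j) (c (n ∸ j)))
    foldr-zipWith-coefficientsDown G φ c zero = ℤP.+-identityʳ (G (φ 0) (c 0))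
    foldr-zipWith-coefficientsDown G φ c (suc n) = trans
      (cong (λ s → G (φ 0) (c (suc n)) + s) (foldr-zipWith-coefficientsDown G (λ j → φ (suc j)) c n))
      (sym (sumTo-sucˡ n (λ j → G (φ j) (c (suc n ∸ j)))))

  inv-suc : ∀ f n → inv f (suc n) ≡ - sumTo n (λ j → f (suc j) * inv f (n ∸ j))
  inv-suc f n = begin
    - foldr _+_ (+ 0) (zipWith tail (upTo (length (invRev f n))) (invRev f n))
      ≡⟨ cong (λ r → - foldr _+_ (+ 0) (zipWith tail (upTo (length r)) r)) (invRev≡coefficientsDown f n) ⟩
    - foldr _+_ (+ 0) (zipWith tail (upTo (length (coefficientsDown (inv f) n))) (coefficientsDown (inv f) n))
      ≡⟨ cong (λ L → - foldr _+_ (+ 0) (zipWith tail (upTo L) (coefficientsDown (inv f) n)))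
              (length-coefficientsDown (inv f) n) ⟩
    - foldr _+_ (+ 0) (zipWith tail (upTo (suc n)) (coefficientsDown (inv f) n))
      ≡⟨ cong -_ (foldr-zipWith-coefficientsDown tail (λ j → j) (inv f) n) ⟩
    - sumTo n (λ j → f (suc j) * inv f (n ∸ j))
      ∎
    where
    tail : ℕ → ℤ → ℤ
    tail j c = f (suc j) * c

  inv-inverseʳ : ∀ f → f 0 ≡ + 1 → (f ⊛ inv f) ≗ one
  inv-inverseʳ f f₀≡1 zero = cong (_* + 1) f₀≡1
  inv-inverseʳ f f₀≡1 (suc n) = begin
    sumTo (suc n) (λ i → f i * inv f (suc n ∸ i))    ≡⟨ sumTo-sucˡ n _ ⟩
    f 0 * inv f (suc n) + tail                       ≡⟨ cong₂ (λ a b → a * b + tail) f₀≡1 (inv-suc f n) ⟩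
    + 1 * - tail + tail                              ≡⟨ cong (_+ tail) (ℤP.*-identityˡ (- tail)) ⟩
    - tail + tail                                    ≡⟨ ℤP.+-inverseˡ tail ⟩
    + 0                                              ∎
    where
    tail : ℤ
    tail = sumTo n (λ j → f (suc j) * inv f (n ∸ j))

module _ where
  open import Relation.Binary.Reasoning.Setoid S.setoid
  open import Algebra.Properties.CommutativeSemigroup S.*-commutativeSemigroup using (interchange)

  inv-inverseˡ : ∀ f → f 0 ≡ + 1 → (inv f ⊛ f) ≗ one
  inv-inverseˡ f f₀≡1 n = trans (⊛-comm (inv f) f n) (inv-inverseʳ f f₀≡1 n)

  ⊛-inv-cancelʳ : ∀ f g → f 0 ≡ + 1 → ((g ⊛ f) ⊛ inv f) ≗ g
  ⊛-inv-cancelʳ f g f₀≡1 = begin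
    (g ⊛ f) ⊛ inv f    ≈⟨ S.*-assoc g f (inv f) ⟩
    g ⊛ (f ⊛ inv f)    ≈⟨ ⊛-congˡ g (inv-inverseʳ f f₀≡1) ⟩
    g ⊛ one            ≈⟨ S.*-identityʳ g ⟩
    g                  ∎

  inv-unique : ∀ f g → f 0 ≡ + 1 → (g ⊛ f) ≗ one → inv f ≗ g
  inv-unique f g f₀≡1 gf≗1 = begin
    inv f              ≈⟨ S.*-identityˡ (inv f) ⟨
    one ⊛ inv f        ≈⟨ ⊛-congʳ (inv f) gf≗1 ⟨
    (g ⊛ f) ⊛ inv f    ≈⟨ ⊛-inv-cancelʳ f g f₀≡1 ⟩
    g                  ∎

  inv-⊛ : ∀ f g → f 0 ≡ + 1 → g 0 ≡ + 1 → inv (f ⊛ g) ≗ (inv f ⊛ inv g)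
  inv-⊛ f g f₀≡1 g₀≡1 = inv-unique (f ⊛ g) (inv f ⊛ inv g) (cong₂ ℤ._*_ f₀≡1 g₀≡1) (begin
    (inv f ⊛ inv g) ⊛ (f ⊛ g)  ≈⟨ interchange (inv f) (inv g) f g ⟩
    (inv f ⊛ f) ⊛ (inv g ⊛ g)  ≈⟨ S.*-cong (inv-inverseˡ f f₀≡1) (inv-inverseˡ g g₀≡1) ⟩
    one ⊛ one                  ≈⟨ S.*-identityˡ one ⟩
    one                        ∎)

qPoch-constant : ∀ n → qPoch n 0 ≡ + 1
qPoch-constant zero = refl
qPoch-constant (suc n) = cong (ℤ._* + 1) (qPoch-constant n)

⊛-one⊖ : ∀ f g → (f ⊛ (one ⊖ g)) ≗ (f ⊖ (g ⊛ f))
⊛-one⊖ f g n = begin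
  (f ⊛ (one ⊖ g)) n          ≡⟨ solve 3 (λ f o g → f :* (o :- g) := (f :* o) :- (g :* f)) (λ _ → refl) f one g n ⟩
  ((f ⊛ one) ⊖ (g ⊛ f)) n    ≡⟨ cong (ℤ._- (g ⊛ f) n) (⊛-identityʳ f n) ⟩
  (f ⊖ (g ⊛ f)) n            ∎
  where open ≡-Reasoning

one⊖qPow-+ : ∀ a b → ((one ⊖ qPow b) ⊕ (qPow b ⊛ (one ⊖ qPow a))) ≗ (one ⊖ qPow (a ℕ.+ b))
one⊖qPow-+ a b n = begin
  (one n ℤ.- qPow b n) ℤ.+ (qPow b ⊛ (one ⊖ qPow a)) n
    ≡⟨ cong (λ x → (one n ℤ.- qPow b n) ℤ.+ x) (⊛-one⊖ (qPow b) (qPow a) n) ⟩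
  (one n ℤ.- qPow b n) ℤ.+ (qPow b n ℤ.- (qPow a ⊛ qPow b) n)
    ≡⟨ cong (λ x → (one n ℤ.- qPow b n) ℤ.+ (qPow b n ℤ.- x)) (qPow-+ a b n) ⟩
  (one n ℤ.- qPow b n) ℤ.+ (qPow b n ℤ.- qPow (a ℕ.+ b) n)
    ≡⟨ ℤP.+-minus-telescope (one n) (qPow b n) (qPow (a ℕ.+ b) n) ⟩
  one n ℤ.- qPow (a ℕ.+ b) n
    ∎
  where open ≡-Reasoning

module _ where
  open import Relation.Binary.Reasoning.Setoid S.setoid
  open import Algebra.Properties.CommutativeSemigroup S.*-commutativeSemigroup using (x∙yz≈xz∙y)

  ⊛-one⊖-cancel : ∀ A B g → A ≗ (B ⊕ (g ⊛ A)) → (A ⊛ (one ⊖ g)) ≗ B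
  ⊛-one⊖-cancel A B g A≗B+gA = begin
    A ⊛ (one ⊖ g)               ≈⟨ ⊛-one⊖ A g ⟩
    A ⊖ (g ⊛ A)                 ≈⟨ (λ n → cong (ℤ._- (g ⊛ A) n) (A≗B+gA n)) ⟩
    (B ⊕ (g ⊛ A)) ⊖ (g ⊛ A)     ≈⟨ solve 2 (λ b x → (b :+ x) :- x := b) (λ _ → refl) B (g ⊛ A) ⟩
    B                           ∎

  recurrence⇒⊛qPoch≗one : (A : ℕ → Series) → A 0 ≗ one →
    (∀ n → A (suc n) ≗ (A n ⊕ (qPow (suc n) ⊛ A (suc n)))) →
    ∀ n → (A n ⊛ qPoch n) ≗ one
  recurrence⇒⊛qPoch≗one A A₀≗1 step zero = begin
    A 0 ⊛ one     ≈⟨ ⊛-identityʳ (A 0) ⟩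
    A 0           ≈⟨ A₀≗1 ⟩
    one           ∎
  recurrence⇒⊛qPoch≗one A A₀≗1 step (suc n) = begin
    A (suc n) ⊛ (qPoch n ⊛ (one ⊖ qPow (suc n)))    ≈⟨ x∙yz≈xz∙y (A (suc n)) (qPoch n) (one ⊖ qPow (suc n)) ⟩
    (A (suc n) ⊛ (one ⊖ qPow (suc n))) ⊛ qPoch n    ≈⟨ ⊛-congʳ (qPoch n) (⊛-one⊖-cancel (A (suc n)) (A n) (qPow (suc n)) (step n)) ⟩
    A n ⊛ qPoch n                                   ≈⟨ recurrence⇒⊛qPoch≗one A A₀≗1 step n ⟩
    one                                             ∎

  recurrence⇒inv-qPoch : (A : ℕ → Series) → A 0 ≗ one →
    (∀ n → A (suc n) ≗ (A n ⊕ (qPow (suc n) ⊛ A (suc n)))) →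
    ∀ n → inv (qPoch n) ≗ A n
  recurrence⇒inv-qPoch A A₀≗1 step n = inv-unique (qPoch n) (A n) (qPoch-constant n) (recurrence⇒⊛qPoch≗one A A₀≗1 step n)

  -- Multiplied by (q;q)_{L+1} (q;q)_{c+1}, the two terms of the recurrence become (q;q)_{L+c+1} times
  -- the two summands of 1 − q^{L+c+2} in one⊖qPow-+.
  box-recurrence⇒⊛qPoch : (G : ℕ → ℕ → Series) → (∀ c → G 0 c ≗ one) → (∀ L → G L 0 ≗ one) →
    (∀ L c → G (suc L) (suc c) ≗ (G (suc L) c ⊕ (qPow (suc c) ⊛ G L (suc c)))) →
    ∀ L c → (G L c ⊛ (qPoch L ⊛ qPoch c)) ≗ qPoch (L ℕ.+ c)
  box-recurrence⇒⊛qPoch G G₀c≗1 GL₀≗1 step L zero = begin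
    G L 0 ⊛ (qPoch L ⊛ one)   ≈⟨ ⊛-cong (GL₀≗1 L) (⊛-identityʳ (qPoch L)) ⟩
    one ⊛ qPoch L             ≈⟨ ⊛-identityˡ (qPoch L) ⟩
    qPoch L                   ≡⟨ cong qPoch (ℕP.+-identityʳ L) ⟨
    qPoch (L ℕ.+ 0)           ∎
  box-recurrence⇒⊛qPoch G G₀c≗1 GL₀≗1 step zero (suc c) = begin
    G 0 (suc c) ⊛ (one ⊛ qPoch (suc c))   ≈⟨ ⊛-cong (G₀c≗1 (suc c)) (⊛-identityˡ (qPoch (suc c))) ⟩
    one ⊛ qPoch (suc c)                   ≈⟨ ⊛-identityˡ (qPoch (suc c)) ⟩
    qPoch (suc c)                         ∎
  box-recurrence⇒⊛qPoch G G₀c≗1 GL₀≗1 step (suc L) (suc c) = begin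
    G (suc L) (suc c) ⊛ ((X ⊛ u) ⊛ (Y ⊛ v))
      ≈⟨ ⊛-congʳ ((X ⊛ u) ⊛ (Y ⊛ v)) (step L c) ⟩
    (A ⊕ (qc ⊛ B)) ⊛ ((X ⊛ u) ⊛ (Y ⊛ v))
      ≈⟨ solve 7 (λ A B X Y u v qc → (A :+ (qc :* B)) :* ((X :* u) :* (Y :* v)) :=
                   ((A :* ((X :* u) :* Y)) :* v) :+ ((B :* (X :* (Y :* v))) :* (qc :* u)))
               (λ _ → refl) A B X Y u v qc ⟩
    ((A ⊛ ((X ⊛ u) ⊛ Y)) ⊛ v) ⊕ ((B ⊛ (X ⊛ (Y ⊛ v))) ⊛ (qc ⊛ u))
      ≈⟨ S.+-cong (⊛-congʳ v smaller-bound) (⊛-congʳ (qc ⊛ u) (box-recurrence⇒⊛qPoch G G₀c≗1 GL₀≗1 step L (suc c))) ⟩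
    (Z ⊛ v) ⊕ (Z ⊛ (qc ⊛ u))
      ≈⟨ ⊛-distribˡ-⊕ Z v (qc ⊛ u) ⟨
    Z ⊛ (v ⊕ (qc ⊛ u))
      ≈⟨ ⊛-congˡ Z (one⊖qPow-+ (suc L) (suc c)) ⟩
    Z ⊛ (one ⊖ qPow (suc L ℕ.+ suc c))
      ∎
    where
    X Y u v qc A B Z : Series
    X = qPoch L
    Y = qPoch c
    u = one ⊖ qPow (suc L)
    v = one ⊖ qPow (suc c)
    qc = qPow (suc c)
    A = G (suc L) c
    B = G L (suc c)
    Z = qPoch (L ℕ.+ suc c)
    smaller-bound : (A ⊛ ((X ⊛ u) ⊛ Y)) ≗ Z
    smaller-bound n = trans (box-recurrence⇒⊛qPoch G G₀c≗1 GL₀≗1 step (suc L) c n)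
                             (cong (λ k → qPoch k n) (sym (ℕP.+-suc L c)))

  box-recurrence⇒qBinom : (G : ℕ → ℕ → Series) → (∀ c → G 0 c ≗ one) → (∀ L → G L 0 ≗ one) →
    (∀ L c → G (suc L) (suc c) ≗ (G (suc L) c ⊕ (qPow (suc c) ⊛ G L (suc c)))) →
    ∀ L c → qBinom (L ℕ.+ c) c ≗ G L c
  box-recurrence⇒qBinom G G₀c≗1 GL₀≗1 step L c = begin
    qPoch (L ℕ.+ c) ⊛ inv (qPoch c ⊛ qPoch (L ℕ.+ c ∸ c))
      ≡⟨ cong (λ k → qPoch (L ℕ.+ c) ⊛ inv (qPoch c ⊛ qPoch k)) (ℕP.m+n∸n≡m L c) ⟩
    qPoch (L ℕ.+ c) ⊛ inv D
      ≈⟨ ⊛-congʳ (inv D) (box-recurrence⇒⊛qPoch G G₀c≗1 GL₀≗1 step L c) ⟨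
    (G L c ⊛ (qPoch L ⊛ qPoch c)) ⊛ inv D
      ≈⟨ ⊛-congʳ (inv D) (⊛-congˡ (G L c) (⊛-comm (qPoch L) (qPoch c))) ⟩
    (G L c ⊛ D) ⊛ inv D
      ≈⟨ ⊛-inv-cancelʳ D (G L c) (cong₂ ℤ._*_ (qPoch-constant c) (qPoch-constant L)) ⟩
    G L c
      ∎
    where
    D : Series
    D = qPoch c ⊛ qPoch L

-- Finite sets and generating functions of graded families

Finite : Set → Set
Finite A = Σ ℕ (λ c → Fin c ↔ A)

card : ∀ {A : Set} → Finite A → ℕ
card = proj₁

card-unique : ∀ {A : Set} {a b} → Fin a ↔ A → Fin b ↔ A → a ≡ b
card-unique e₁ e₂ = FP.cantor-schröder-bernstein
  (Injection.injective (↔⇒↣ (↔-trans e₁ (↔-sym e₂)))) (Injection.injective (↔⇒↣ (↔-trans e₂ (↔-sym e₁))))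

card-cong : ∀ {A B : Set} (fa : Finite A) (fb : Finite B) → A ↔ B → card fa ≡ card fb
card-cong (_ , ea) (_ , eb) e = card-unique (↔-trans ea e) eb

finite-↔ : ∀ {A B : Set} → Finite A → A ↔ B → Finite B
finite-↔ (c , ea) e = c , ↔-trans ea e

finite-empty : ∀ {A : Set} → ¬ A → Finite A
finite-empty ¬a = 0 , mk↔ₛ′ (λ ()) (λ a → ⊥-elim (¬a a)) (λ a → ⊥-elim (¬a a)) (λ ())

finite-⊎ : ∀ {A B : Set} → Finite A → Finite B → Finite (A ⊎ B)
finite-⊎ (a , ea) (b , eb) = a ℕ.+ b , ↔-trans FP.+↔⊎ (ea ⊎-↔ eb)

finite-× : ∀ {A B : Set} → Finite A → Finite B → Finite (A × B)
finite-× (a , ea) (b , eb) = a ℕ.* b , ↔-trans FP.*↔× (ea ×-↔ eb)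

Σ≤ : ℕ → (ℕ → Set) → Set
Σ≤ n B = Σ ℕ (λ a → a ℕ.≤ n × B a)

Σ≤-zero↔ : ∀ (B : ℕ → Set) → Σ≤ 0 B ↔ B 0
Σ≤-zero↔ B = mk↔ₛ′ (λ { (zero , z≤n , x) → x }) (λ x → 0 , z≤n , x) (λ _ → refl) (λ { (zero , z≤n , x) → refl })

Σ≤-suc↔ : ∀ n (B : ℕ → Set) → Σ≤ (suc n) B ↔ (B 0 ⊎ Σ≤ n (λ a → B (suc a)))
Σ≤-suc↔ n B = mk↔ₛ′
  (λ { (zero , z≤n , x) → inj₁ x ; (suc a , s≤s a≤n , x) → inj₂ (a , a≤n , x) })
  (λ { (inj₁ x) → 0 , z≤n , x ; (inj₂ (a , a≤n , x)) → suc a , s≤s a≤n , x })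
  (λ { (inj₁ x) → refl ; (inj₂ _) → refl })
  (λ { (zero , z≤n , x) → refl ; (suc a , s≤s a≤n , x) → refl })

finite-Σ≤ : ∀ n (B : ℕ → Set) → (∀ a → Finite (B a)) → Finite (Σ≤ n B)
finite-Σ≤ zero B fb = finite-↔ (fb 0) (↔-sym (Σ≤-zero↔ B))
finite-Σ≤ (suc n) B fb = finite-↔ (finite-⊎ (fb 0) (finite-Σ≤ n (λ a → B (suc a)) (λ a → fb (suc a)))) (↔-sym (Σ≤-suc↔ n B))

card-Σ≤ : ∀ n (B : ℕ → Set) (fb : ∀ a → Finite (B a)) → + card (finite-Σ≤ n B fb) ≡ sumTo n (λ a → + card (fb a))
card-Σ≤ zero B fb = refl
card-Σ≤ (suc n) B fb = begin
  + (card (fb 0) ℕ.+ card (finite-Σ≤ n (λ a → B (suc a)) (λ a → fb (suc a))))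
    ≡⟨ ℤP.pos-+ (card (fb 0)) _ ⟩
  + card (fb 0) ℤ.+ + card (finite-Σ≤ n (λ a → B (suc a)) (λ a → fb (suc a)))
    ≡⟨ cong (λ x → + card (fb 0) ℤ.+ x) (card-Σ≤ n (λ a → B (suc a)) (λ a → fb (suc a))) ⟩
  + card (fb 0) ℤ.+ sumTo n (λ a → + card (fb (suc a)))
    ≡⟨ sumTo-sucˡ n (λ a → + card (fb a)) ⟨
  sumTo (suc n) (λ a → + card (fb a))
    ∎
  where open ≡-Reasoning

Counted : (ℕ → Set) → Set
Counted C = ∀ N → Finite (C N)

gf : ∀ {C} → Counted C → Series
gf fc N = + card (fc N)

gf-cong : ∀ {C D} (fc : Counted C) (fd : Counted D) → (∀ N → C N ↔ D N) → gf fc ≗ gf fd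
gf-cong fc fd C↔D N = cong +_ (card-cong (fc N) (fd N) (C↔D N))

card-empty : ∀ {A : Set} (fa : Finite A) → ¬ A → card fa ≡ 0
card-empty fa ¬a = card-cong fa (finite-empty ¬a) ↔-refl

Shift : ℕ → (ℕ → Set) → ℕ → Set
Shift e C N = Σ (e ℕ.≤ N) (λ _ → C (N ∸ e))

Shift↔ : ∀ {e N} C → e ℕ.≤ N → Shift e C N ↔ C (N ∸ e)
Shift↔ C e≤N = mk↔ₛ′ proj₂ (e≤N ,_) (λ _ → refl) (λ { (p , c) → cong (_, c) (ℕP.≤-irrelevant e≤N p) })

finite-Shift : ∀ e C N → (e ℕ.≤ N → Finite (C (N ∸ e))) → Finite (Shift e C N)
finite-Shift e C N fc with e ℕ.≤? N
... | yes e≤N = finite-↔ (fc e≤N) (↔-sym (Shift↔ C e≤N))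
... | no e≰N = finite-empty (λ (e≤N , _) → e≰N e≤N)

counted-Shift : ∀ e {C} → Counted C → Counted (Shift e C)
counted-Shift e {C} fc N = finite-Shift e C N (λ _ → fc (N ∸ e))

gf-Shift : ∀ e {C} (fc : Counted C) → gf (counted-Shift e fc) ≗ (qPow e ⊛ gf fc)
gf-Shift e {C} fc N = by-cases (e ℕ.≤? N)
  where
  by-cases : Dec (e ℕ.≤ N) → gf (counted-Shift e fc) N ≡ (qPow e ⊛ gf fc) N
  by-cases (yes e≤N) = trans (cong +_ (card-cong (counted-Shift e fc N) (fc (N ∸ e)) (Shift↔ C e≤N)))
                             (sym (qPow-⊛-≤ e (gf fc) N e≤N))
  by-cases (no e≰N) = trans (cong +_ (card-empty (counted-Shift e fc N) (λ (e≤N , _) → e≰N e≤N)))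
                            (sym (qPow-⊛-< e (gf fc) N (ℕP.≰⇒> e≰N)))

counted-⊎ : ∀ {C D} → Counted C → Counted D → Counted (λ N → C N ⊎ D N)
counted-⊎ fc fd N = finite-⊎ (fc N) (fd N)

gf-⊎ : ∀ {C D} (fc : Counted C) (fd : Counted D) → gf (counted-⊎ fc fd) ≗ (gf fc ⊕ gf fd)
gf-⊎ fc fd N = ℤP.pos-+ (card (fc N)) (card (fd N))

_⋆_ : (ℕ → Set) → (ℕ → Set) → ℕ → Set
(C ⋆ D) N = Σ≤ N (λ i → C i × D (N ∸ i))

counted-⋆ : ∀ {C D} → Counted C → Counted D → Counted (C ⋆ D)
counted-⋆ fc fd N = finite-Σ≤ N _ (λ i → finite-× (fc i) (fd (N ∸ i)))

gf-⋆ : ∀ {C D} (fc : Counted C) (fd : Counted D) → gf (counted-⋆ fc fd) ≗ (gf fc ⊛ gf fd)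
gf-⋆ fc fd N = trans (card-Σ≤ N _ (λ i → finite-× (fc i) (fd (N ∸ i))))
                     (sumTo-cong N (λ i _ → ℤP.pos-* (card (fc i)) (card (fd (N ∸ i)))))

counted-recursive : ∀ {C C₁} e → Counted C₁ → (∀ N → C N ↔ (C₁ N ⊎ Shift (suc e) C N)) → Counted C
counted-recursive {C} e f₁ split = <-rec (λ N → Finite (C N)) λ N rec →
  finite-↔ (finite-⊎ (f₁ N) (finite-Shift (suc e) C N (λ e<N → rec (ℕP.∸-monoʳ-< {o = 0} (s≤s z≤n) e<N))))
           (↔-sym (split N))

gf-split : ∀ {C C₁ C₂} e (fc : Counted C) (f₁ : Counted C₁) (f₂ : Counted C₂) →
  (∀ N → C N ↔ (C₁ N ⊎ Shift e C₂ N)) → gf fc ≗ (gf f₁ ⊕ (qPow e ⊛ gf f₂))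
gf-split e fc f₁ f₂ split N = begin
  gf fc N                                                   ≡⟨ gf-cong fc (counted-⊎ f₁ (counted-Shift e f₂)) split N ⟩
  gf (counted-⊎ f₁ (counted-Shift e f₂)) N                   ≡⟨ gf-⊎ f₁ (counted-Shift e f₂) N ⟩
  gf f₁ N ℤ.+ gf (counted-Shift e f₂) N                      ≡⟨ cong (λ x → gf f₁ N ℤ.+ x) (gf-Shift e f₂ N) ⟩
  gf f₁ N ℤ.+ (qPow e ⊛ gf f₂) N                             ∎
  where open ≡-Reasoning

counted-unit : Counted (λ N → N ≡ 0)
counted-unit zero = 1 , mk↔ₛ′ (λ _ → refl) (λ _ → Fin.zero) (λ _ → ℕP.≡-irrelevant _ _) (λ { Fin.zero → refl ; (Fin.suc ()) })
counted-unit (suc N) = finite-empty (λ ())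

gf-unit : ∀ {C} (fc : Counted C) → (∀ N → C N ↔ (N ≡ 0)) → gf fc ≗ one
gf-unit fc C↔unit N = trans (gf-cong fc counted-unit C↔unit N) (unit N)
  where
  unit : gf counted-unit ≗ one
  unit zero = refl
  unit (suc N) = refl

OfWeight : {X : Set} → (X → Set) → (X → ℕ) → ℕ → Set
OfWeight {X} P w N = Σ X (λ x → P x × w x ≡ N)

OfWeight-≡ : ∀ {X : Set} {P : X → Set} {w N} → Irrelevant P →
  ∀ {x x′ p p′ e e′} → x ≡ x′ → _≡_ {A = OfWeight P w N} (x , p , e) (x′ , p′ , e′)
OfWeight-≡ irr {p = p} {p′} {e} {e′} refl = cong₂ (λ p e → (_ , p , e)) (irr p p′) (ℕP.≡-irrelevant e e′)

OfWeight-shift : ∀ {X : Set} (P : X → Set) (w : X → ℕ) e N →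
  OfWeight P (λ x → e ℕ.+ w x) N ↔ Shift e (OfWeight P w) N
OfWeight-shift P w e N = mk↔ₛ′ to from
  (λ (_ , (x , p , eq)) → cong₂ (λ le eq → le , (x , p , eq)) (ℕP.≤-irrelevant _ _) (ℕP.≡-irrelevant _ _))
  (λ (x , p , eq) → cong (λ eq → x , p , eq) (ℕP.≡-irrelevant _ _))
  where
  to : OfWeight P (λ x → e ℕ.+ w x) N → Shift e (OfWeight P w) N
  to (x , p , eq) = subst (e ℕ.≤_) eq (ℕP.m≤m+n e (w x)) , (x , p , trans (sym (ℕP.m+n∸m≡n e (w x))) (cong (_∸ e) eq))
  from : Shift e (OfWeight P w) N → OfWeight P (λ x → e ℕ.+ w x) N
  from (e≤N , (x , p , eq)) = x , p , trans (cong (e ℕ.+_) eq) (ℕP.m+[n∸m]≡n e≤N)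

OfWeight-pair : ∀ {X Y : Set} (P : X → Set) (Q : Y → Set) (w : X → ℕ) (v : Y → ℕ) N →
  OfWeight (P ⟨×⟩ Q) (λ (x , y) → w x ℕ.+ v y) N ↔ (OfWeight P w ⋆ OfWeight Q v) N
OfWeight-pair P Q w v N = mk↔ₛ′ to from to∘from
  (λ ((x , y) , (p , q) , eq) → cong (λ eq → (x , y) , (p , q) , eq) (ℕP.≡-irrelevant _ _))
  where
  to : OfWeight (P ⟨×⟩ Q) (λ (x , y) → w x ℕ.+ v y) N → (OfWeight P w ⋆ OfWeight Q v) N
  to ((x , y) , (p , q) , eq) =
    w x , subst (w x ℕ.≤_) eq (ℕP.m≤m+n (w x) (v y)) , (x , p , refl) , (y , q , trans (sym (ℕP.m+n∸m≡n (w x) (v y))) (cong (_∸ w x) eq))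
  from : (OfWeight P w ⋆ OfWeight Q v) N → OfWeight (P ⟨×⟩ Q) (λ (x , y) → w x ℕ.+ v y) N
  from (i , i≤N , (x , p , eq₁) , (y , q , eq₂)) = (x , y) , (p , q) , trans (cong₂ ℕ._+_ eq₁ eq₂) (ℕP.m+[n∸m]≡n i≤N)
  to∘from : ∀ z → to (from z) ≡ z
  to∘from (i , i≤N , (x , p , refl) , (y , q , eq₂)) =
    cong₂ (λ le eq → w x , le , (x , p , refl) , (y , q , eq)) (ℕP.≤-irrelevant _ _) (ℕP.≡-irrelevant _ _)

Σ≤-cong : ∀ n {B B′ : ℕ → Set} → (∀ a → B a ↔ B′ a) → Σ≤ n B ↔ Σ≤ n B′
Σ≤-cong n B↔B′ = Σ-↔ ↔-refl (↔-refl ×-↔ B↔B′ _)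

Shift-cong : ∀ e {C D : ℕ → Set} → (∀ M → C M ↔ D M) → ∀ N → Shift e C N ↔ Shift e D N
Shift-cong e C↔D N = Σ-↔ ↔-refl (C↔D (N ∸ e))

⋆-congʳ : ∀ C {D D′ : ℕ → Set} → (∀ M → D M ↔ D′ M) → ∀ N → (C ⋆ D) N ↔ (C ⋆ D′) N
⋆-congʳ C D↔D′ N = Σ≤-cong N (λ i → ↔-refl ×-↔ D↔D′ (N ∸ i))

-- Weakly decreasing sequences

-- DecreasingFrom b xs means b ≥ x₁ ≥ x₂ ≥ ⋯ (b itself is not an entry).
data DecreasingFrom (b : ℕ) : List ℕ → Set where
  [] : DecreasingFrom b []
  _∷_ : ∀ {x xs} → x ≤ b → DecreasingFrom x xs → DecreasingFrom b (x ∷ xs)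

Decreasing : List ℕ → Set
Decreasing [] = ⊤
Decreasing (x ∷ xs) = DecreasingFrom x xs

DecreasingFrom-irrelevant : ∀ {b} → Irrelevant (DecreasingFrom b)
DecreasingFrom-irrelevant [] [] = refl
DecreasingFrom-irrelevant (p ∷ d) (p′ ∷ d′) = cong₂ _∷_ (ℕP.≤-irrelevant p p′) (DecreasingFrom-irrelevant d d′)

Decreasing-irrelevant : Irrelevant Decreasing
Decreasing-irrelevant {[]} tt tt = refl
Decreasing-irrelevant {x ∷ xs} = DecreasingFrom-irrelevant

DecreasingFrom-weaken : ∀ {b b′ xs} → b ≤ b′ → DecreasingFrom b xs → DecreasingFrom b′ xs
DecreasingFrom-weaken b≤b′ [] = []
DecreasingFrom-weaken b≤b′ (x≤b ∷ d) = ℕP.≤-trans x≤b b≤b′ ∷ d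

All-≥-irrelevant : ∀ {c} → Irrelevant (All (c ≤_))
All-≥-irrelevant = All.irrelevant ℕP.≤-irrelevant

DecreasingFrom-map-+ : ∀ c {u xs} → DecreasingFrom u xs → DecreasingFrom (c ℕ.+ u) (map (c ℕ.+_) xs)
DecreasingFrom-map-+ c [] = []
DecreasingFrom-map-+ c (x≤u ∷ d) = ℕP.+-monoʳ-≤ c x≤u ∷ DecreasingFrom-map-+ c d

Decreasing-map-+ : ∀ c xs → Decreasing xs → Decreasing (map (c ℕ.+_) xs)
Decreasing-map-+ c [] _ = tt
Decreasing-map-+ c (x ∷ xs) d = DecreasingFrom-map-+ c d

DecreasingFrom-map-∸ : ∀ c {u xs} → DecreasingFrom u xs → All (c ≤_) xs → DecreasingFrom (u ∸ c) (map (_∸ c) xs)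
DecreasingFrom-map-∸ c [] [] = []
DecreasingFrom-map-∸ c (x≤u ∷ d) (_ ∷ c≤xs) = ℕP.∸-monoˡ-≤ c x≤u ∷ DecreasingFrom-map-∸ c d c≤xs

Decreasing-map-∸ : ∀ c xs → Decreasing xs → All (c ≤_) xs → Decreasing (map (_∸ c) xs)
Decreasing-map-∸ c [] _ _ = tt
Decreasing-map-∸ c (x ∷ xs) d (_ ∷ c≤xs) = DecreasingFrom-map-∸ c d c≤xs

All-≥-map-+ : ∀ {c} d xs → c ≤ d → All (c ≤_) (map (d ℕ.+_) xs)
All-≥-map-+ d [] c≤d = []
All-≥-map-+ d (x ∷ xs) c≤d = ℕP.≤-trans c≤d (ℕP.m≤m+n d x) ∷ All-≥-map-+ d xs c≤d

map-+-∸ : ∀ c xs → All (c ≤_) xs → map (c ℕ.+_) (map (_∸ c) xs) ≡ xs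
map-+-∸ c [] [] = refl
map-+-∸ c (x ∷ xs) (c≤x ∷ c≤xs) = cong₂ _∷_ (ℕP.m+[n∸m]≡n c≤x) (map-+-∸ c xs c≤xs)

map-+-injective : ∀ c {xs ys} → map (c ℕ.+_) xs ≡ map (c ℕ.+_) ys → xs ≡ ys
map-+-injective c = LP.map-injective (ℕP.+-cancelˡ-≡ c _ _)

sum-map-+ : ∀ c xs → sum (map (c ℕ.+_) xs) ≡ length xs ℕ.* c ℕ.+ sum xs
sum-map-+ c [] = refl
sum-map-+ c (x ∷ xs) = trans (cong ((c ℕ.+ x) ℕ.+_) (sum-map-+ c xs)) (rearrange c x (length xs) (sum xs))
  where
  rearrange : ∀ c x n s → (c ℕ.+ x) ℕ.+ (n ℕ.* c ℕ.+ s) ≡ (c ℕ.+ n ℕ.* c) ℕ.+ (x ℕ.+ s)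
  rearrange = solve-∀

map-∸-+ : ∀ c xs → map (_∸ c) (map (c ℕ.+_) xs) ≡ xs
map-∸-+ c [] = refl
map-∸-+ c (x ∷ xs) = cong₂ _∷_ (ℕP.m+n∸m≡n c x) (map-∸-+ c xs)

DecreasingFrom-∷ʳ0 : ∀ {b} xs → DecreasingFrom b xs → DecreasingFrom b (xs ∷ʳ 0)
DecreasingFrom-∷ʳ0 [] [] = z≤n ∷ []
DecreasingFrom-∷ʳ0 (x ∷ xs) (x≤b ∷ d) = x≤b ∷ DecreasingFrom-∷ʳ0 xs d

Decreasing-∷ʳ0 : ∀ xs → Decreasing xs → Decreasing (xs ∷ʳ 0)
Decreasing-∷ʳ0 [] _ = []
Decreasing-∷ʳ0 (x ∷ xs) d = DecreasingFrom-∷ʳ0 xs d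

DecreasingFrom-∷ʳ⁻ : ∀ {b} xs y → DecreasingFrom b (xs ∷ʳ y) → DecreasingFrom b xs
DecreasingFrom-∷ʳ⁻ [] y _ = []
DecreasingFrom-∷ʳ⁻ (x ∷ xs) y (x≤b ∷ d) = x≤b ∷ DecreasingFrom-∷ʳ⁻ xs y d

Decreasing-∷ʳ⁻ : ∀ xs y → Decreasing (xs ∷ʳ y) → Decreasing xs
Decreasing-∷ʳ⁻ [] y _ = tt
Decreasing-∷ʳ⁻ (x ∷ xs) y d = DecreasingFrom-∷ʳ⁻ xs y d

∷ʳ0-not-positive : ∀ xs → ¬ All (1 ≤_) (xs ∷ʳ 0)
∷ʳ0-not-positive [] (() ∷ _)
∷ʳ0-not-positive (x ∷ xs) (_ ∷ p) = ∷ʳ0-not-positive xs p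

non-positive⇒ends-with-0 : ∀ x xs → DecreasingFrom x xs → ¬ All (1 ≤_) (x ∷ xs) → Σ (List ℕ) (λ ys → x ∷ xs ≡ ys ∷ʳ 0)
non-positive⇒ends-with-0 zero [] _ _ = [] , refl
non-positive⇒ends-with-0 (suc x) [] _ ¬p = ⊥-elim (¬p (s≤s z≤n ∷ []))
non-positive⇒ends-with-0 x (y ∷ xs) (y≤x ∷ d) ¬p with all? (1 ℕ.≤?_) (y ∷ xs)
... | yes (1≤y ∷ p) = ⊥-elim (¬p (ℕP.≤-trans 1≤y y≤x ∷ 1≤y ∷ p))
... | no ¬p′ with ys , eq ← non-positive⇒ends-with-0 y xs d ¬p′ = x ∷ ys , cong (x ∷_) eq

sum-∷ʳ0 : ∀ xs → sum (xs ∷ʳ 0) ≡ sum xs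
sum-∷ʳ0 [] = refl
sum-∷ʳ0 (x ∷ xs) = cong (x ℕ.+_) (sum-∷ʳ0 xs)

length-∷ʳ : ∀ (xs : List ℕ) y → length (xs ∷ʳ y) ≡ suc (length xs)
length-∷ʳ [] y = refl
length-∷ʳ (x ∷ xs) y = cong suc (length-∷ʳ xs y)

DecreasingFrom⇒All≤ : ∀ {u xs} → DecreasingFrom u xs → All (_≤ u) xs
DecreasingFrom⇒All≤ [] = []
DecreasingFrom⇒All≤ (x≤u ∷ d) = x≤u ∷ All.map (λ y≤x → ℕP.≤-trans y≤x x≤u) (DecreasingFrom⇒All≤ d)

DecreasingFrom-++ : ∀ {u v xs ys} → DecreasingFrom u xs → All (v ≤_) xs → v ≤ u → DecreasingFrom v ys →
  DecreasingFrom u (xs ++ ys)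
DecreasingFrom-++ [] [] v≤u d = DecreasingFrom-weaken v≤u d
DecreasingFrom-++ (x≤u ∷ d) (v≤x ∷ v≤xs) v≤u d′ = x≤u ∷ DecreasingFrom-++ d v≤xs v≤x d′

DecreasingFrom-++-∷⁻ : ∀ {u} xs {y ys} → DecreasingFrom u (xs ++ y ∷ ys) →
  All (y ≤_) xs × DecreasingFrom u xs × DecreasingFrom y ys
DecreasingFrom-++-∷⁻ [] (y≤u ∷ d) = [] , [] , d
DecreasingFrom-++-∷⁻ (x ∷ xs) (x≤u ∷ d) with y≤xs , d₁ , d₂ ← DecreasingFrom-++-∷⁻ xs d =
  All.head (AllP.++⁻ʳ xs (DecreasingFrom⇒All≤ d)) ∷ y≤xs , x≤u ∷ d₁ , d₂

Decreasing-++-∷⁻ : ∀ xs {y ys} → Decreasing (xs ++ y ∷ ys) → All (y ≤_) xs × Decreasing xs × DecreasingFrom y ys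
Decreasing-++-∷⁻ [] d = [] , tt , d
Decreasing-++-∷⁻ (x ∷ xs) d with y≤xs , d₁ , d₂ ← DecreasingFrom-++-∷⁻ xs d =
  All.head (AllP.++⁻ʳ xs (DecreasingFrom⇒All≤ d)) ∷ y≤xs , d₁ , d₂

++-cancel-length : ∀ (xs xs′ : List ℕ) {ys ys′} → length xs ≡ length xs′ → xs ++ ys ≡ xs′ ++ ys′ → xs ≡ xs′ × ys ≡ ys′
++-cancel-length [] [] _ eq = refl , eq
++-cancel-length (x ∷ xs) (x′ ∷ xs′) len eq with x≡x′ , eq′ ← LP.∷-injective eq
  with xs≡xs′ , ys≡ys′ ← ++-cancel-length xs xs′ (ℕP.suc-injective len) eq′ = cong₂ _∷_ x≡x′ xs≡xs′ , ys≡ys′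

++-cancel-threshold : ∀ j (xs xs′ : List ℕ) {ys ys′} → All (suc j ≤_) xs → All (suc j ≤_) xs′ →
  All (_≤ j) ys → All (_≤ j) ys′ → xs ++ ys ≡ xs′ ++ ys′ → xs ≡ xs′ × ys ≡ ys′
++-cancel-threshold j [] [] _ _ _ _ eq = refl , eq
++-cancel-threshold j [] (x′ ∷ xs′) _ (j<x′ ∷ _) (y≤j ∷ _) _ eq =
  ⊥-elim (ℕP.≤⇒≯ y≤j (subst (j ℕ.<_) (sym (proj₁ (LP.∷-injective eq))) j<x′))
++-cancel-threshold j (x ∷ xs) [] (j<x ∷ _) _ _ (y′≤j ∷ _) eq =
  ⊥-elim (ℕP.≤⇒≯ y′≤j (subst (j ℕ.<_) (proj₁ (LP.∷-injective eq)) j<x))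
++-cancel-threshold j (x ∷ xs) (x′ ∷ xs′) (_ ∷ j<xs) (_ ∷ j<xs′) ys≤j ys′≤j eq with x≡x′ , eq′ ← LP.∷-injective eq
  with xs≡xs′ , ys≡ys′ ← ++-cancel-threshold j xs xs′ j<xs j<xs′ ys≤j ys′≤j eq′ = cong₂ _∷_ x≡x′ xs≡xs′ , ys≡ys′

span-> : ∀ j {u} xs → DecreasingFrom u xs →
  Σ (List ℕ) λ xs₁ → Σ (List ℕ) λ xs₂ → xs ≡ xs₁ ++ xs₂ × All (suc j ≤_) xs₁ × DecreasingFrom u xs₁ × DecreasingFrom j xs₂
span-> j [] [] = [] , [] , refl , [] , [] , []
span-> j (x ∷ xs) (x≤u ∷ d) with suc j ℕ.≤? x
... | yes j<x with xs₁ , xs₂ , eq , j<xs₁ , d₁ , d₂ ← span-> j xs d =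
  x ∷ xs₁ , xs₂ , cong (x ∷_) eq , j<x ∷ j<xs₁ , x≤u ∷ d₁ , d₂
... | no j≮x = [] , x ∷ xs , refl , [] , [] , ℕP.≮⇒≥ j≮x ∷ d

-- Three families counted by q-Pochhammer quotients

BoundedPartition : ℕ → List ℕ → Set
BoundedPartition b xs = DecreasingFrom b xs × All (1 ≤_) xs

BoundedPartition-irrelevant : ∀ {b} → Irrelevant (BoundedPartition b)
BoundedPartition-irrelevant (d , p) (d′ , p′) = cong₂ _,_ (DecreasingFrom-irrelevant d d′) (All-≥-irrelevant p p′)

BoundedPartitions : ℕ → ℕ → Set
BoundedPartitions b = OfWeight (BoundedPartition b) sum

BoundedPartitions-zero↔ : ∀ N → BoundedPartitions 0 N ↔ (N ≡ 0)
BoundedPartitions-zero↔ N = mk↔ₛ′ to (λ N≡0 → [] , ([] , []) , sym N≡0) (λ _ → ℕP.≡-irrelevant _ _) from∘to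
  where
  to : BoundedPartitions 0 N → N ≡ 0
  to ([] , _ , eq) = sym eq
  to (x ∷ _ , (x≤0 ∷ _ , 1≤x ∷ _) , _) = ⊥-elim (ℕP.<⇒≱ 1≤x x≤0)
  from∘to : ∀ p → ([] , ([] , []) , sym (to p)) ≡ p
  from∘to ([] , _ , eq) = OfWeight-≡ BoundedPartition-irrelevant refl
  from∘to (x ∷ _ , (x≤0 ∷ _ , 1≤x ∷ _) , _) = ⊥-elim (ℕP.<⇒≱ 1≤x x≤0)

BoundedPartitions-suc↔ : ∀ b N →
  BoundedPartitions (suc b) N ↔ (BoundedPartitions b N ⊎ OfWeight (BoundedPartition (suc b)) (λ xs → suc b ℕ.+ sum xs) N)
BoundedPartitions-suc↔ b N = mk↔ₛ′ to from to∘from from∘to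
  where
  irr = BoundedPartition-irrelevant
  Lowered = OfWeight (BoundedPartition (suc b)) (λ xs → suc b ℕ.+ sum xs) N
  to : BoundedPartitions (suc b) N → BoundedPartitions b N ⊎ Lowered
  to ([] , _ , eq) = inj₁ ([] , ([] , []) , eq)
  to (x ∷ xs , (x≤1+b ∷ d , 1≤x ∷ p) , eq) with x ℕ.≤? b
  ... | yes x≤b = inj₁ (x ∷ xs , (x≤b ∷ d , 1≤x ∷ p) , eq)
  ... | no x≰b = inj₂ (xs , (DecreasingFrom-weaken x≤1+b d , p) ,
                       trans (cong (ℕ._+ sum xs) (ℕP.≤-antisym (ℕP.≰⇒> x≰b) x≤1+b)) eq)
  from : BoundedPartitions b N ⊎ Lowered → BoundedPartitions (suc b) N
  from (inj₁ (xs , (d , p) , eq)) = xs , (DecreasingFrom-weaken (ℕP.n≤1+n b) d , p) , eq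
  from (inj₂ (xs , (d , p) , eq)) = suc b ∷ xs , (ℕP.≤-refl ∷ d , s≤s z≤n ∷ p) , eq
  from∘to : ∀ p → from (to p) ≡ p
  from∘to ([] , _ , eq) = OfWeight-≡ irr refl
  from∘to (x ∷ xs , (x≤1+b ∷ d , 1≤x ∷ p) , eq) with x ℕ.≤? b
  ... | yes x≤b = OfWeight-≡ irr refl
  ... | no x≰b = OfWeight-≡ irr (cong (_∷ xs) (ℕP.≤-antisym (ℕP.≰⇒> x≰b) x≤1+b))
  to∘from : ∀ p → to (from p) ≡ p
  to∘from (inj₁ ([] , (d , p) , eq)) = cong inj₁ (OfWeight-≡ irr refl)
  to∘from (inj₁ (x ∷ xs , (x≤b ∷ d , 1≤x ∷ p) , eq)) with x ℕ.≤? b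
  ... | yes _ = cong inj₁ (OfWeight-≡ irr refl)
  ... | no x≰b = ⊥-elim (x≰b x≤b)
  to∘from (inj₂ (xs , (d , p) , eq)) with suc b ℕ.≤? b
  ... | yes 1+b≤b = ⊥-elim (ℕP.<-irrefl refl 1+b≤b)
  ... | no _ = cong inj₂ (OfWeight-≡ irr refl)

BoundedPartitions-recursion : ∀ b N →
  BoundedPartitions (suc b) N ↔ (BoundedPartitions b N ⊎ Shift (suc b) (BoundedPartitions (suc b)) N)
BoundedPartitions-recursion b N =
  ↔-trans (BoundedPartitions-suc↔ b N) (↔-refl ⊎-↔ OfWeight-shift (BoundedPartition (suc b)) sum (suc b) N)

counted-BoundedPartitions : ∀ b → Counted (BoundedPartitions b)
counted-BoundedPartitions zero N = finite-↔ (counted-unit N) (↔-sym (BoundedPartitions-zero↔ N))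
counted-BoundedPartitions (suc b) =
  counted-recursive b (counted-BoundedPartitions b) (BoundedPartitions-recursion b)

gf-BoundedPartitions : ∀ b → inv (qPoch b) ≗ gf (counted-BoundedPartitions b)
gf-BoundedPartitions = recurrence⇒inv-qPoch (λ b → gf (counted-BoundedPartitions b))
  (gf-unit (counted-BoundedPartitions 0) BoundedPartitions-zero↔)
  (λ b → gf-split (suc b) (counted-BoundedPartitions (suc b)) (counted-BoundedPartitions b) (counted-BoundedPartitions (suc b))
           (BoundedPartitions-recursion b))

DecreasingOfLength : ℕ → List ℕ → Set
DecreasingOfLength n xs = length xs ≡ n × Decreasing xs

DecreasingOfLength-irrelevant : ∀ {n} → Irrelevant (DecreasingOfLength n)
DecreasingOfLength-irrelevant (l , d) (l′ , d′) = cong₂ _,_ (ℕP.≡-irrelevant l l′) (Decreasing-irrelevant d d′)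

DecreasingSequences : ℕ → ℕ → Set
DecreasingSequences n = OfWeight (DecreasingOfLength n) sum

DecreasingSequences-zero↔ : ∀ N → DecreasingSequences 0 N ↔ (N ≡ 0)
DecreasingSequences-zero↔ N = mk↔ₛ′ (λ { ([] , _ , eq) → sym eq }) (λ N≡0 → [] , (refl , tt) , sym N≡0)
  (λ _ → ℕP.≡-irrelevant _ _) (λ { ([] , _ , eq) → OfWeight-≡ DecreasingOfLength-irrelevant refl })

sum-map-suc : ∀ xs → sum (map (1 ℕ.+_) xs) ≡ length xs ℕ.+ sum xs
sum-map-suc xs = trans (sum-map-+ 1 xs) (cong (ℕ._+ sum xs) (ℕP.*-identityʳ (length xs)))

sum-map-∸1 : ∀ xs → All (1 ≤_) xs → length xs ℕ.+ sum (map (_∸ 1) xs) ≡ sum xs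
sum-map-∸1 xs 1≤xs = begin
  length xs ℕ.+ sum (map (_∸ 1) xs)                ≡⟨ cong (ℕ._+ sum (map (_∸ 1) xs)) (LP.length-map (_∸ 1) xs) ⟨
  length (map (_∸ 1) xs) ℕ.+ sum (map (_∸ 1) xs)   ≡⟨ sum-map-suc (map (_∸ 1) xs) ⟨
  sum (map (1 ℕ.+_) (map (_∸ 1) xs))               ≡⟨ cong sum (map-+-∸ 1 xs 1≤xs) ⟩
  sum xs                                           ∎
  where open ≡-Reasoning

-- A decreasing sequence either has only positive entries, which can all be lowered by one,
-- or ends in a zero, which can be dropped.
DecreasingSequences-suc↔ : ∀ n N →
  DecreasingSequences (suc n) N ↔ (DecreasingSequences n N ⊎ OfWeight (DecreasingOfLength (suc n)) (λ xs → suc n ℕ.+ sum xs) N)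
DecreasingSequences-suc↔ n N = mk↔ₛ′ to from to∘from from∘to
  where
  irr = DecreasingOfLength-irrelevant
  Lowered = OfWeight (DecreasingOfLength (suc n)) (λ xs → suc n ℕ.+ sum xs) N
  to : DecreasingSequences (suc n) N → DecreasingSequences n N ⊎ Lowered
  to (x ∷ xs , (len , d) , eq) with all? (1 ℕ.≤?_) (x ∷ xs)
  ... | yes 1≤xs = inj₂ (map (_∸ 1) (x ∷ xs) , (trans (LP.length-map _ (x ∷ xs)) len , Decreasing-map-∸ 1 (x ∷ xs) d 1≤xs) ,
                         trans (cong (ℕ._+ sum (map (_∸ 1) (x ∷ xs))) (sym len)) (trans (sum-map-∸1 (x ∷ xs) 1≤xs) eq))
  ... | no ¬1≤xs = let ys , x∷xs≡ys∷ʳ0 = non-positive⇒ends-with-0 x xs d ¬1≤xs in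
    inj₁ (ys , (ℕP.suc-injective (trans (sym (length-∷ʳ ys 0)) (trans (cong length (sym x∷xs≡ys∷ʳ0)) len)) ,
                Decreasing-∷ʳ⁻ ys 0 (subst Decreasing x∷xs≡ys∷ʳ0 d)) ,
               trans (sym (sum-∷ʳ0 ys)) (trans (cong sum (sym x∷xs≡ys∷ʳ0)) eq))
  from : DecreasingSequences n N ⊎ Lowered → DecreasingSequences (suc n) N
  from (inj₁ (ys , (len , d) , eq)) = ys ∷ʳ 0 , (trans (length-∷ʳ ys 0) (cong suc len) , Decreasing-∷ʳ0 ys d) , trans (sum-∷ʳ0 ys) eq
  from (inj₂ (ys , (len , d) , eq)) = map (1 ℕ.+_) ys , (trans (LP.length-map _ ys) len , Decreasing-map-+ 1 ys d) ,
    trans (sum-map-suc ys) (trans (cong (ℕ._+ sum ys) len) eq)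
  from∘to : ∀ p → from (to p) ≡ p
  from∘to (x ∷ xs , (len , d) , eq) with all? (1 ℕ.≤?_) (x ∷ xs)
  ... | yes 1≤xs = OfWeight-≡ irr (map-+-∸ 1 (x ∷ xs) 1≤xs)
  ... | no ¬1≤xs = OfWeight-≡ irr (sym (proj₂ (non-positive⇒ends-with-0 x xs d ¬1≤xs)))
  to∘from : ∀ p → to (from p) ≡ p
  to∘from (inj₁ ([] , (len , d) , eq)) = cong inj₁ (OfWeight-≡ irr refl)
  to∘from (inj₁ (y ∷ ys , (len , d) , eq)) with all? (1 ℕ.≤?_) (y ∷ ys ∷ʳ 0)
  ... | yes 1≤ys0 = ⊥-elim (∷ʳ0-not-positive (y ∷ ys) 1≤ys0)
  ... | no ¬1≤ys0 = cong inj₁ (OfWeight-≡ irr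
    (proj₁ (LP.∷ʳ-injective _ (y ∷ ys) (sym (proj₂ (non-positive⇒ends-with-0 y (ys ∷ʳ 0) (DecreasingFrom-∷ʳ0 ys d) ¬1≤ys0))))))
  to∘from (inj₂ ([] , (() , _) , _))
  to∘from (inj₂ (y ∷ ys , (len , d) , eq)) with all? (1 ℕ.≤?_) (map (1 ℕ.+_) (y ∷ ys))
  ... | yes _ = cong inj₂ (OfWeight-≡ irr (map-∸-+ 1 (y ∷ ys)))
  ... | no ¬1≤ys = ⊥-elim (¬1≤ys (All-≥-map-+ 1 (y ∷ ys) ℕP.≤-refl))

DecreasingSequences-recursion : ∀ n N →
  DecreasingSequences (suc n) N ↔ (DecreasingSequences n N ⊎ Shift (suc n) (DecreasingSequences (suc n)) N)
DecreasingSequences-recursion n N =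
  ↔-trans (DecreasingSequences-suc↔ n N) (↔-refl ⊎-↔ OfWeight-shift (DecreasingOfLength (suc n)) sum (suc n) N)

counted-DecreasingSequences : ∀ n → Counted (DecreasingSequences n)
counted-DecreasingSequences zero N = finite-↔ (counted-unit N) (↔-sym (DecreasingSequences-zero↔ N))
counted-DecreasingSequences (suc n) =
  counted-recursive n (counted-DecreasingSequences n) (DecreasingSequences-recursion n)

gf-DecreasingSequences : ∀ n → inv (qPoch n) ≗ gf (counted-DecreasingSequences n)
gf-DecreasingSequences = recurrence⇒inv-qPoch (λ n → gf (counted-DecreasingSequences n))
  (gf-unit (counted-DecreasingSequences 0) DecreasingSequences-zero↔)
  (λ n → gf-split (suc n) (counted-DecreasingSequences (suc n)) (counted-DecreasingSequences n) (counted-DecreasingSequences (suc n))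
           (DecreasingSequences-recursion n))

InBox : ℕ → ℕ → List ℕ → Set
InBox L c xs = length xs ≡ L × DecreasingFrom c xs

InBox-irrelevant : ∀ {L c} → Irrelevant (InBox L c)
InBox-irrelevant (l , d) (l′ , d′) = cong₂ _,_ (ℕP.≡-irrelevant l l′) (DecreasingFrom-irrelevant d d′)

BoxPartitions : ℕ → ℕ → ℕ → Set
BoxPartitions L c = OfWeight (InBox L c) sum

BoxPartitions-zero-rows↔ : ∀ c N → BoxPartitions 0 c N ↔ (N ≡ 0)
BoxPartitions-zero-rows↔ c N = mk↔ₛ′ (λ { ([] , _ , eq) → sym eq }) (λ N≡0 → [] , (refl , []) , sym N≡0)
  (λ _ → ℕP.≡-irrelevant _ _) (λ { ([] , _ , eq) → OfWeight-≡ InBox-irrelevant refl })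

sum-DecreasingFrom-0 : ∀ {xs} → DecreasingFrom 0 xs → sum xs ≡ 0
sum-DecreasingFrom-0 [] = refl
sum-DecreasingFrom-0 (z≤n ∷ d) = sum-DecreasingFrom-0 d

DecreasingFrom-0⇒replicate : ∀ {xs} L → length xs ≡ L → DecreasingFrom 0 xs → xs ≡ replicate L 0
DecreasingFrom-0⇒replicate zero refl [] = refl
DecreasingFrom-0⇒replicate (suc L) len (z≤n ∷ d) = cong (0 ∷_) (DecreasingFrom-0⇒replicate L (ℕP.suc-injective len) d)

DecreasingFrom-0-replicate : ∀ L → DecreasingFrom 0 (replicate L 0)
DecreasingFrom-0-replicate zero = []
DecreasingFrom-0-replicate (suc L) = z≤n ∷ DecreasingFrom-0-replicate L

BoxPartitions-zero-columns↔ : ∀ L N → BoxPartitions L 0 N ↔ (N ≡ 0)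
BoxPartitions-zero-columns↔ L N = mk↔ₛ′
  (λ (_ , (_ , d) , eq) → trans (sym eq) (sum-DecreasingFrom-0 d))
  (λ N≡0 → replicate L 0 , (LP.length-replicate L , DecreasingFrom-0-replicate L) ,
           trans (sum-DecreasingFrom-0 (DecreasingFrom-0-replicate L)) (sym N≡0))
  (λ _ → ℕP.≡-irrelevant _ _)
  (λ (_ , (len , d) , _) → OfWeight-≡ InBox-irrelevant (sym (DecreasingFrom-0⇒replicate L len d)))

BoxPartitions-suc↔ : ∀ L c N →
  BoxPartitions (suc L) (suc c) N ↔ (BoxPartitions (suc L) c N ⊎ OfWeight (InBox L (suc c)) (λ xs → suc c ℕ.+ sum xs) N)
BoxPartitions-suc↔ L c N = mk↔ₛ′ to from to∘from from∘to
  where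
  irr = InBox-irrelevant
  Lowered = OfWeight (InBox L (suc c)) (λ xs → suc c ℕ.+ sum xs) N
  to : BoxPartitions (suc L) (suc c) N → BoxPartitions (suc L) c N ⊎ Lowered
  to (x ∷ xs , (len , x≤1+c ∷ d) , eq) with x ℕ.≤? c
  ... | yes x≤c = inj₁ (x ∷ xs , (len , x≤c ∷ d) , eq)
  ... | no x≰c = inj₂ (xs , (ℕP.suc-injective len , DecreasingFrom-weaken x≤1+c d) ,
                       trans (cong (ℕ._+ sum xs) (ℕP.≤-antisym (ℕP.≰⇒> x≰c) x≤1+c)) eq)
  from : BoxPartitions (suc L) c N ⊎ Lowered → BoxPartitions (suc L) (suc c) N
  from (inj₁ (xs , (len , d) , eq)) = xs , (len , DecreasingFrom-weaken (ℕP.n≤1+n c) d) , eq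
  from (inj₂ (xs , (len , d) , eq)) = suc c ∷ xs , (cong suc len , ℕP.≤-refl ∷ d) , eq
  from∘to : ∀ p → from (to p) ≡ p
  from∘to (x ∷ xs , (len , x≤1+c ∷ d) , eq) with x ℕ.≤? c
  ... | yes x≤c = OfWeight-≡ irr refl
  ... | no x≰c = OfWeight-≡ irr (cong (_∷ xs) (ℕP.≤-antisym (ℕP.≰⇒> x≰c) x≤1+c))
  to∘from : ∀ p → to (from p) ≡ p
  to∘from (inj₁ (x ∷ xs , (len , x≤c ∷ d) , eq)) with x ℕ.≤? c
  ... | yes _ = cong inj₁ (OfWeight-≡ irr refl)
  ... | no x≰c = ⊥-elim (x≰c x≤c)
  to∘from (inj₂ (xs , (len , d) , eq)) with suc c ℕ.≤? c
  ... | yes 1+c≤c = ⊥-elim (ℕP.<-irrefl refl 1+c≤c)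
  ... | no _ = cong inj₂ (OfWeight-≡ irr refl)

BoxPartitions-recursion : ∀ L c N →
  BoxPartitions (suc L) (suc c) N ↔ (BoxPartitions (suc L) c N ⊎ Shift (suc c) (BoxPartitions L (suc c)) N)
BoxPartitions-recursion L c N =
  ↔-trans (BoxPartitions-suc↔ L c N) (↔-refl ⊎-↔ OfWeight-shift (InBox L (suc c)) sum (suc c) N)

counted-BoxPartitions : ∀ L c → Counted (BoxPartitions L c)
counted-BoxPartitions L zero N = finite-↔ (counted-unit N) (↔-sym (BoxPartitions-zero-columns↔ L N))
counted-BoxPartitions zero (suc c) N = finite-↔ (counted-unit N) (↔-sym (BoxPartitions-zero-rows↔ (suc c) N))
counted-BoxPartitions (suc L) (suc c) N =
  finite-↔ (counted-⊎ (counted-BoxPartitions (suc L) c) (counted-Shift (suc c) (counted-BoxPartitions L (suc c))) N)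
           (↔-sym (BoxPartitions-recursion L c N))

gf-BoxPartitions : ∀ L c → qBinom (L ℕ.+ c) c ≗ gf (counted-BoxPartitions L c)
gf-BoxPartitions = box-recurrence⇒qBinom (λ L c → gf (counted-BoxPartitions L c))
  (λ c → gf-unit (counted-BoxPartitions 0 c) (BoxPartitions-zero-rows↔ c))
  (λ L → gf-unit (counted-BoxPartitions L 0) (BoxPartitions-zero-columns↔ L))
  (λ L c → gf-split (suc c) (counted-BoxPartitions (suc L) (suc c)) (counted-BoxPartitions (suc L) c) (counted-BoxPartitions L (suc c))
             (BoxPartitions-recursion L c))

-- Cutting a partition along a hook

part-++-∷ : ∀ xs y ys → part (xs ++ y ∷ ys) (suc (length xs)) ≡ y
part-++-∷ [] y ys = refl
part-++-∷ (x ∷ xs) y ys = part-++-∷ xs y ys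

conj-++ : ∀ j xs ys → All (suc j ≤_) xs → All (_≤ j) ys → conj (xs ++ ys) (suc j) ≡ length xs
conj-++ j xs ys j<xs ys≤j = begin
  length (filter (suc j ℕ.≤?_) (xs ++ ys))
    ≡⟨ cong length (LP.filter-++ (suc j ℕ.≤?_) xs ys) ⟩
  length (filter (suc j ℕ.≤?_) xs ++ filter (suc j ℕ.≤?_) ys)
    ≡⟨ cong₂ (λ u v → length (u ++ v)) (LP.filter-all (suc j ℕ.≤?_) j<xs) (LP.filter-none (suc j ℕ.≤?_) (All.map ℕP.≤⇒≯ ys≤j)) ⟩
  length (xs ++ [])
    ≡⟨ cong length (LP.++-identityʳ xs) ⟩
  length xs
    ∎
  where open ≡-Reasoning

hook-≡ : ∀ λs i j h → part λs i ℕ.+ conj λs j ℕ.+ 1 ≡ h ℕ.+ i ℕ.+ j → hook λs i j ≡ h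
hook-≡ λs i j h eq = cong ∣_∣ (begin
  + p ℤ.+ + c ℤ.- + i ℤ.- + j ℤ.+ + 1       ≡⟨ regroup (+ p) (+ c) (+ i) (+ j) ⟩
  (+ p ℤ.+ + c ℤ.+ + 1) ℤ.- + i ℤ.- + j     ≡⟨ cong (λ x → x ℤ.- + i ℤ.- + j) (sym (pos-+₃ p c 1)) ⟩
  + (p ℕ.+ c ℕ.+ 1) ℤ.- + i ℤ.- + j         ≡⟨ cong (λ x → + x ℤ.- + i ℤ.- + j) eq ⟩
  + (h ℕ.+ i ℕ.+ j) ℤ.- + i ℤ.- + j         ≡⟨ cong (λ x → x ℤ.- + i ℤ.- + j) (pos-+₃ h i j) ⟩
  (+ h ℤ.+ + i ℤ.+ + j) ℤ.- + i ℤ.- + j     ≡⟨ cancel (+ h) (+ i) (+ j) ⟩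
  + h                                       ∎)
  where
  open ≡-Reasoning
  p = part λs i
  c = conj λs j
  pos-+₃ : ∀ x y z → + (x ℕ.+ y ℕ.+ z) ≡ + x ℤ.+ + y ℤ.+ + z
  pos-+₃ x y z = trans (ℤP.pos-+ (x ℕ.+ y) z) (cong (ℤ._+ + z) (ℤP.pos-+ x y))
  regroup : ∀ P C I J → P ℤ.+ C ℤ.- I ℤ.- J ℤ.+ + 1 ≡ (P ℤ.+ C ℤ.+ + 1) ℤ.- I ℤ.- J
  regroup = Z.solve-∀
  cancel : ∀ H I J → (H ℤ.+ I ℤ.+ J) ℤ.- I ℤ.- J ≡ H
  cancel = Z.solve-∀

split-at-row : ∀ n xs → 1 ≤ part xs (suc n) →
  Σ (List ℕ) λ pre → Σ ℕ λ x → Σ (List ℕ) λ rest → xs ≡ pre ++ x ∷ rest × length pre ≡ n × part xs (suc n) ≡ x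
split-at-row n [] ()
split-at-row zero (y ∷ xs) _ = [] , y , xs , refl , refl , refl
split-at-row (suc n) (y ∷ xs) 1≤part with pre , x , rest , eq , len , part≡x ← split-at-row n xs 1≤part =
  y ∷ pre , x , rest , cong (y ∷_) eq , cong suc len , part≡x

-- The hook cell is (s′ + 1, m′ + 1).
module HookDecomposition (m′ s′ : ℕ) where

  m : ℕ
  m = suc m′

  -- Row s′ + 1 has length m + a; the rows above it are those of t raised by m + a, the leg rows below it
  -- those of md raised by m, and the remaining rows b are shorter than m.
  assemble : ℕ → List ℕ → List ℕ → List ℕ → List ℕ
  assemble a t md b = map ((m ℕ.+ a) ℕ.+_) t ++ (m ℕ.+ a) ∷ (map (m ℕ.+_) md ++ b)

  assemble-part : ∀ a t md b → length t ≡ s′ → part (assemble a t md b) (suc s′) ≡ m ℕ.+ a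
  assemble-part a t md b len = subst (λ n → part (assemble a t md b) (suc n) ≡ m ℕ.+ a) (trans (LP.length-map _ t) len)
    (part-++-∷ (map ((m ℕ.+ a) ℕ.+_) t) (m ℕ.+ a) (map (m ℕ.+_) md ++ b))

  assemble-conj : ∀ a t md b → length t ≡ s′ → DecreasingFrom m′ b → conj (assemble a t md b) m ≡ s′ ℕ.+ suc (length md)
  assemble-conj a t md b len db = begin
    conj (assemble a t md b) m     ≡⟨ cong (λ xs → conj xs m) (LP.++-assoc (map ((m ℕ.+ a) ℕ.+_) t) (m ℕ.+ a ∷ map (m ℕ.+_) md) b) ⟨
    conj (upper ++ b) m            ≡⟨ conj-++ m′ upper b m≤upper (DecreasingFrom⇒All≤ db) ⟩
    length upper                   ≡⟨ LP.length-++ (map ((m ℕ.+ a) ℕ.+_) t) ⟩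
    length (map ((m ℕ.+ a) ℕ.+_) t) ℕ.+ suc (length (map (m ℕ.+_) md))
      ≡⟨ cong₂ (λ u v → u ℕ.+ suc v) (trans (LP.length-map _ t) len) (LP.length-map _ md) ⟩
    s′ ℕ.+ suc (length md)         ∎
    where
    open ≡-Reasoning
    upper = map ((m ℕ.+ a) ℕ.+_) t ++ m ℕ.+ a ∷ map (m ℕ.+_) md
    m≤upper : All (m ≤_) upper
    m≤upper = AllP.++⁺ (All-≥-map-+ (m ℕ.+ a) t (ℕP.m≤m+n m a)) (ℕP.m≤m+n m a ∷ All-≥-map-+ m md ℕP.≤-refl)

  assemble-hook : ∀ a t md b → length t ≡ s′ → DecreasingFrom m′ b → hook (assemble a t md b) (suc s′) m ≡ suc (a ℕ.+ length md)
  assemble-hook a t md b len db = hook-≡ (assemble a t md b) (suc s′) m (suc (a ℕ.+ length md)) (begin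
    part (assemble a t md b) (suc s′) ℕ.+ conj (assemble a t md b) m ℕ.+ 1
      ≡⟨ cong₂ (λ p c → p ℕ.+ c ℕ.+ 1) (assemble-part a t md b len) (assemble-conj a t md b len db) ⟩
    (m ℕ.+ a) ℕ.+ (s′ ℕ.+ suc (length md)) ℕ.+ 1
      ≡⟨ arm+leg m′ a s′ (length md) ⟩
    suc (a ℕ.+ length md) ℕ.+ suc s′ ℕ.+ m
      ∎)
    where
    open ≡-Reasoning
    arm+leg : ∀ m′ a s′ L → (suc m′ ℕ.+ a) ℕ.+ (s′ ℕ.+ suc L) ℕ.+ 1 ≡ suc (a ℕ.+ L) ℕ.+ suc s′ ℕ.+ suc m′
    arm+leg = solve-∀

  assemble-sum : ∀ a t md b → length t ≡ s′ →
    sum (assemble a t md b) ≡ (suc s′ ℕ.* (m ℕ.+ a) ℕ.+ length md ℕ.* m) ℕ.+ (sum t ℕ.+ (sum md ℕ.+ sum b))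
  assemble-sum a t md b len = begin
    sum (map ((m ℕ.+ a) ℕ.+_) t ++ (m ℕ.+ a) ∷ (map (m ℕ.+_) md ++ b))
      ≡⟨ ΣP.sum-++ (map ((m ℕ.+ a) ℕ.+_) t) _ ⟩
    sum (map ((m ℕ.+ a) ℕ.+_) t) ℕ.+ ((m ℕ.+ a) ℕ.+ sum (map (m ℕ.+_) md ++ b))
      ≡⟨ cong (λ x → sum (map ((m ℕ.+ a) ℕ.+_) t) ℕ.+ ((m ℕ.+ a) ℕ.+ x)) (ΣP.sum-++ (map (m ℕ.+_) md) b) ⟩
    sum (map ((m ℕ.+ a) ℕ.+_) t) ℕ.+ ((m ℕ.+ a) ℕ.+ (sum (map (m ℕ.+_) md) ℕ.+ sum b))
      ≡⟨ cong₂ (λ u v → u ℕ.+ ((m ℕ.+ a) ℕ.+ (v ℕ.+ sum b))) (sum-map-+ (m ℕ.+ a) t) (sum-map-+ m md) ⟩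
    (length t ℕ.* (m ℕ.+ a) ℕ.+ sum t) ℕ.+ ((m ℕ.+ a) ℕ.+ ((length md ℕ.* m ℕ.+ sum md) ℕ.+ sum b))
      ≡⟨ cong (λ n → (n ℕ.* (m ℕ.+ a) ℕ.+ sum t) ℕ.+ ((m ℕ.+ a) ℕ.+ ((length md ℕ.* m ℕ.+ sum md) ℕ.+ sum b))) len ⟩
    (s′ ℕ.* (m ℕ.+ a) ℕ.+ sum t) ℕ.+ ((m ℕ.+ a) ℕ.+ ((length md ℕ.* m ℕ.+ sum md) ℕ.+ sum b))
      ≡⟨ rearrange s′ (m ℕ.+ a) (sum t) (length md ℕ.* m) (sum md) (sum b) ⟩
    (suc s′ ℕ.* (m ℕ.+ a) ℕ.+ length md ℕ.* m) ℕ.+ (sum t ℕ.+ (sum md ℕ.+ sum b))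
      ∎
    where
    open ≡-Reasoning
    rearrange : ∀ s x st lm sm sb → (s ℕ.* x ℕ.+ st) ℕ.+ (x ℕ.+ ((lm ℕ.+ sm) ℕ.+ sb)) ≡ (suc s ℕ.* x ℕ.+ lm) ℕ.+ (st ℕ.+ (sm ℕ.+ sb))
    rearrange = solve-∀

  assemble-decreasing : ∀ arm above leg below → Decreasing above → DecreasingFrom arm leg → DecreasingFrom m′ below →
    Decreasing (assemble arm above leg below)
  assemble-decreasing arm [] leg below _ dleg dbelow = lower-rows
    where
    lower-rows : DecreasingFrom (m ℕ.+ arm) (map (m ℕ.+_) leg ++ below)
    lower-rows = DecreasingFrom-++ (DecreasingFrom-map-+ m dleg) (All-≥-map-+ m leg ℕP.≤-refl) (ℕP.m≤m+n m arm)
                                   (DecreasingFrom-weaken (ℕP.n≤1+n m′) dbelow)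
  assemble-decreasing arm (y ∷ above) leg below dabove dleg dbelow =
    DecreasingFrom-++ (DecreasingFrom-map-+ (m ℕ.+ arm) dabove) (All-≥-map-+ (m ℕ.+ arm) above ℕP.≤-refl) (ℕP.m≤m+n (m ℕ.+ arm) y)
      (ℕP.≤-refl ∷ assemble-decreasing arm [] leg below tt dleg dbelow)

  assemble-positive : ∀ arm above leg below → All (1 ≤_) below → All (1 ≤_) (assemble arm above leg below)
  assemble-positive arm above leg below pos =
    AllP.++⁺ (All-≥-map-+ (m ℕ.+ arm) above (s≤s z≤n)) (s≤s z≤n ∷ AllP.++⁺ (All-≥-map-+ m leg (s≤s z≤n)) pos)

  assemble-injective : ∀ arm above leg below arm′ above′ leg′ below′ → length above ≡ s′ → length above′ ≡ s′ →
    DecreasingFrom m′ below → DecreasingFrom m′ below′ → assemble arm above leg below ≡ assemble arm′ above′ leg′ below′ →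
    arm ≡ arm′ × above ≡ above′ × leg ≡ leg′ × below ≡ below′
  assemble-injective arm above leg below arm′ above′ leg′ below′ len len′ dbelow dbelow′ eq
    with refl ← ℕP.+-cancelˡ-≡ m arm arm′ (trans (sym (assemble-part arm above leg below len))
                                             (trans (cong (λ xs → part xs (suc s′)) eq) (assemble-part arm′ above′ leg′ below′ len′)))
    with above≡ , rest≡ ← ++-cancel-length (map ((m ℕ.+ arm) ℕ.+_) above) (map ((m ℕ.+ arm) ℕ.+_) above′)
                            (trans (LP.length-map _ above) (trans len (sym (trans (LP.length-map _ above′) len′)))) eq
    with leg≡ , below≡ ← ++-cancel-threshold m′ (map (m ℕ.+_) leg) (map (m ℕ.+_) leg′)
                            (All-≥-map-+ m leg ℕP.≤-refl) (All-≥-map-+ m leg′ ℕP.≤-refl)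
                            (DecreasingFrom⇒All≤ dbelow) (DecreasingFrom⇒All≤ dbelow′) (proj₂ (LP.∷-injective rest≡))
    = refl , map-+-injective (m ℕ.+ arm) above≡ , map-+-injective m leg≡ , below≡

  record Decomposition (λs : List ℕ) : Set where
    field
      arm : ℕ
      above leg below : List ℕ
      assembled : λs ≡ assemble arm above leg below
      length-above : length above ≡ s′
      above-decreasing : Decreasing above
      leg-decreasing : DecreasingFrom arm leg
      below-decreasing : DecreasingFrom m′ below
      below-positive : All (1 ≤_) below

  decompose : ∀ λs → Decreasing λs → All (1 ≤_) λs → m ≤ part λs (suc s′) → Decomposition λs
  decompose λs d pos m≤λₛ =
    let pre , x , rest , λs≡ , len , λₛ≡x = split-at-row s′ λs (ℕP.≤-trans (s≤s z≤n) m≤λₛ)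
        x≤pre , dpre , drest = Decreasing-++-∷⁻ pre (subst Decreasing λs≡ d)
        l₁ , l₂ , rest≡ , m≤l₁ , d₁ , d₂ = span-> m′ rest drest
        above = map (_∸ x) pre
        leg = map (_∸ m) l₁
        x≡m+arm : x ≡ m ℕ.+ (x ∸ m)
        x≡m+arm = sym (ℕP.m+[n∸m]≡n (subst (m ≤_) λₛ≡x m≤λₛ))
        assembled = begin
          λs
            ≡⟨ trans λs≡ (cong (λ r → pre ++ x ∷ r) rest≡) ⟩
          pre ++ x ∷ (l₁ ++ l₂)
            ≡⟨ cong₂ (λ u v → u ++ x ∷ (v ++ l₂)) (sym (map-+-∸ x pre x≤pre)) (sym (map-+-∸ m l₁ m≤l₁)) ⟩
          map (x ℕ.+_) above ++ x ∷ (map (m ℕ.+_) leg ++ l₂)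
            ≡⟨ cong (λ y → map (y ℕ.+_) above ++ y ∷ (map (m ℕ.+_) leg ++ l₂)) x≡m+arm ⟩
          assemble (x ∸ m) above leg l₂
            ∎
        1≤rest = All.tail (AllP.++⁻ʳ pre (subst (All (1 ≤_)) λs≡ pos))
    in record
      { arm = x ∸ m ; above = above ; leg = leg ; below = l₂
      ; assembled = assembled
      ; length-above = trans (LP.length-map _ pre) len
      ; above-decreasing = Decreasing-map-∸ x pre dpre x≤pre
      ; leg-decreasing = DecreasingFrom-map-∸ m d₁ m≤l₁
      ; below-decreasing = d₂
      ; below-positive = AllP.++⁻ʳ l₁ (subst (All (1 ≤_)) rest≡ 1≤rest)
      }
    where open ≡-Reasoning


-- Counting partitions with a prescribed hook

T-∧⁻ : ∀ {x y} → T (x ∧ y) → T x × T y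
T-∧⁻ = Equivalence.to BoolP.T-∧

T-∧⁺ : ∀ {x y} → T x → T y → T (x ∧ y)
T-∧⁺ p q = Equivalence.from BoolP.T-∧ (p , q)

Σ-T-≡ : ∀ {A : Set} {b : A → Bool} {x x′} {p : T (b x)} {p′ : T (b x′)} → x ≡ x′ →
  _≡_ {A = Σ A (λ x → T (b x))} (x , p) (x′ , p′)
Σ-T-≡ refl = cong (_ ,_) (BoolP.T-irrelevant _ _)

decreasingᵇ-sound : ∀ xs → T (decreasingᵇ xs) → Decreasing xs
decreasingᵇ-sound [] _ = tt
decreasingᵇ-sound (x ∷ []) _ = []
decreasingᵇ-sound (x ∷ y ∷ xs) p = let y≤x , d = T-∧⁻ {y ℕ.≤ᵇ x} p in ℕP.≤ᵇ⇒≤ y x y≤x ∷ decreasingᵇ-sound (y ∷ xs) d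

decreasingᵇ-complete : ∀ xs → Decreasing xs → T (decreasingᵇ xs)
decreasingᵇ-complete [] _ = tt
decreasingᵇ-complete (x ∷ []) _ = tt
decreasingᵇ-complete (x ∷ y ∷ xs) (y≤x ∷ d) = T-∧⁺ {y ℕ.≤ᵇ x} (ℕP.≤⇒≤ᵇ y≤x) (decreasingᵇ-complete (y ∷ xs) d)

positiveᵇ-sound : ∀ xs → T (positiveᵇ xs) → All (1 ≤_) xs
positiveᵇ-sound [] _ = []
positiveᵇ-sound (x ∷ xs) p = let 1≤x , ps = T-∧⁻ {1 ℕ.≤ᵇ x} p in ℕP.≤ᵇ⇒≤ 1 x 1≤x ∷ positiveᵇ-sound xs ps

positiveᵇ-complete : ∀ xs → All (1 ≤_) xs → T (positiveᵇ xs)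
positiveᵇ-complete [] _ = tt
positiveᵇ-complete (x ∷ xs) (1≤x ∷ ps) = T-∧⁺ {1 ℕ.≤ᵇ x} (ℕP.≤⇒≤ᵇ 1≤x) (positiveᵇ-complete xs ps)

record IsHookPartition (m k s N : ℕ) (λs : List ℕ) : Set where
  field
    decreasing : Decreasing λs
    positive : All (1 ≤_) λs
    size : sum λs ≡ N
    reaches-column : m ≤ part λs s
    hook-length : hook λs s m ≡ k

module _ {m k s N : ℕ} (λs : List ℕ) where

  IsHookPartition-sound : T (isPartitionOfᵇ N λs ∧ fixedHookᵇ m k s λs) → IsHookPartition m k s N λs
  IsHookPartition-sound p =
    let partition , fixed = T-∧⁻ {isPartitionOfᵇ N λs} p
        d , rest = T-∧⁻ {decreasingᵇ λs} partition
        pos , size = T-∧⁻ {positiveᵇ λs} rest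
        tall , hk = T-∧⁻ {m ℕ.≤ᵇ part λs s} fixed
    in record
      { decreasing = decreasingᵇ-sound λs d
      ; positive = positiveᵇ-sound λs pos
      ; size = ℕP.≡ᵇ⇒≡ _ _ size
      ; reaches-column = ℕP.≤ᵇ⇒≤ m _ tall
      ; hook-length = ℕP.≡ᵇ⇒≡ _ _ hk
      }

  IsHookPartition-complete : IsHookPartition m k s N λs → T (isPartitionOfᵇ N λs ∧ fixedHookᵇ m k s λs)
  IsHookPartition-complete H = T-∧⁺ {isPartitionOfᵇ N λs}
    (T-∧⁺ {decreasingᵇ λs} (decreasingᵇ-complete λs decreasing)
      (T-∧⁺ {positiveᵇ λs} (positiveᵇ-complete λs positive) (ℕP.≡⇒≡ᵇ _ _ size)))
    (T-∧⁺ {m ℕ.≤ᵇ part λs s} (ℕP.≤⇒≤ᵇ reaches-column) (ℕP.≡⇒≡ᵇ _ _ hook-length))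
    where open IsHookPartition H

module HookCount (m′ s′ k₀ : ℕ) where
  open HookDecomposition m′ s′

  -- The cells forced by the hook: s′ + 1 rows of length m + a and k₀ ∸ a leg rows of length m.
  frame : ℕ → ℕ
  frame a = suc s′ ℕ.* (m ℕ.+ a) ℕ.+ (k₀ ∸ a) ℕ.* m

  Pieces : ℕ → List ℕ × (List ℕ × List ℕ) → Set
  Pieces a = DecreasingOfLength s′ ⟨×⟩ (InBox (k₀ ∸ a) a ⟨×⟩ BoundedPartition m′)

  Pieces-irrelevant : ∀ {a} → Irrelevant (Pieces a)
  Pieces-irrelevant (t , md , b) (t′ , md′ , b′) =
    cong₂ _,_ (DecreasingOfLength-irrelevant t t′) (cong₂ _,_ (InBox-irrelevant md md′) (BoundedPartition-irrelevant b b′))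

  pieces-weight : List ℕ × (List ℕ × List ℕ) → ℕ
  pieces-weight (t , md , b) = sum t ℕ.+ (sum md ℕ.+ sum b)

  Encoded : ℕ → Set
  Encoded N = Σ≤ k₀ (λ a → OfWeight (Pieces a) (λ p → frame a ℕ.+ pieces-weight p) N)

  encode : ∀ {N λs} → IsHookPartition m (suc k₀) (suc s′) N λs → Encoded N
  encode {N} {λs} H = arm , arm≤k₀ , (above , leg , below) ,
    ((length-above , above-decreasing) , (length-leg , leg-decreasing) , (below-decreasing , below-positive)) , size′
    where
    open IsHookPartition H
    open Decomposition (decompose λs decreasing positive reaches-column)
    arm+leg : arm ℕ.+ length leg ≡ k₀
    arm+leg = ℕP.suc-injective (begin
      suc (arm ℕ.+ length leg)                      ≡⟨ assemble-hook arm above leg below length-above below-decreasing ⟨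
      hook (assemble arm above leg below) (suc s′) m ≡⟨ cong (λ xs → hook xs (suc s′) m) assembled ⟨
      hook λs (suc s′) m                            ≡⟨ hook-length ⟩
      suc k₀                                        ∎)
      where open ≡-Reasoning
    arm≤k₀ : arm ≤ k₀
    arm≤k₀ = subst (arm ≤_) arm+leg (ℕP.m≤m+n arm (length leg))
    length-leg : length leg ≡ k₀ ∸ arm
    length-leg = trans (sym (ℕP.m+n∸m≡n arm (length leg))) (cong (_∸ arm) arm+leg)
    size′ : frame arm ℕ.+ pieces-weight (above , leg , below) ≡ N
    size′ = begin
      frame arm ℕ.+ pieces-weight (above , leg , below)
        ≡⟨ cong (λ L → suc s′ ℕ.* (m ℕ.+ arm) ℕ.+ L ℕ.* m ℕ.+ pieces-weight (above , leg , below)) length-leg ⟨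
      suc s′ ℕ.* (m ℕ.+ arm) ℕ.+ length leg ℕ.* m ℕ.+ pieces-weight (above , leg , below)
        ≡⟨ assemble-sum arm above leg below length-above ⟨
      sum (assemble arm above leg below)
        ≡⟨ cong sum assembled ⟨
      sum λs
        ≡⟨ size ⟩
      N ∎
      where open ≡-Reasoning

  decode : ∀ {N} → Encoded N → Σ (List ℕ) (IsHookPartition m (suc k₀) (suc s′) N)
  decode (a , a≤k₀ , (t , md , b) , ((len-t , dt) , (len-md , dmd) , (db , pb)) , size′) = assemble a t md b , record
    { decreasing = assemble-decreasing a t md b dt dmd db
    ; positive = assemble-positive a t md b pb
    ; size = trans (assemble-sum a t md b len-t)
                   (trans (cong (λ L → suc s′ ℕ.* (m ℕ.+ a) ℕ.+ L ℕ.* m ℕ.+ pieces-weight (t , md , b)) len-md) size′)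
    ; reaches-column = subst (m ≤_) (sym (assemble-part a t md b len-t)) (ℕP.m≤m+n m a)
    ; hook-length = trans (assemble-hook a t md b len-t db) (cong suc (trans (cong (a ℕ.+_) len-md) (ℕP.m+[n∸m]≡n a≤k₀)))
    }

  Encoded-≡ : ∀ {N a a′ ps ps′} {a≤k₀ : a ≤ k₀} {a′≤k₀ : a′ ≤ k₀} {P : Pieces a ps} {P′ : Pieces a′ ps′} {w w′} →
    a ≡ a′ → ps ≡ ps′ → _≡_ {A = Encoded N} (a , a≤k₀ , ps , P , w) (a′ , a′≤k₀ , ps′ , P′ , w′)
  Encoded-≡ refl refl = cong₂ (λ le rest → _ , le , rest) (ℕP.≤-irrelevant _ _) (OfWeight-≡ Pieces-irrelevant refl)

  HookPartitions↔Encoded : ∀ N → HookPartitions m (suc k₀) (suc s′) N ↔ Encoded N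
  HookPartitions↔Encoded N = mk↔ₛ′ to from to∘from from∘to
    where
    to : HookPartitions m (suc k₀) (suc s′) N → Encoded N
    to (λs , p) = encode (IsHookPartition-sound λs p)
    from : Encoded N → HookPartitions m (suc k₀) (suc s′) N
    from e = proj₁ (decode e) , IsHookPartition-complete (proj₁ (decode e)) (proj₂ (decode e))
    from∘to : ∀ x → from (to x) ≡ x
    from∘to (λs , p) =
      Σ-T-≡ {b = λ λs → isPartitionOfᵇ N λs ∧ fixedHookᵇ m (suc k₀) (suc s′) λs} (sym (Decomposition.assembled D))
      where
      open IsHookPartition (IsHookPartition-sound {m} {suc k₀} {suc s′} {N} λs p)
      D = decompose λs decreasing positive reaches-column
    to∘from : ∀ e → to (from e) ≡ e
    to∘from e@(a , _ , (t , md , b) , ((len-t , _) , _ , (db , _)) , _) =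
      let a≡arm , t≡above , md≡leg , b≡below =
            assemble-injective a t md b arm above leg below len-t length-above db below-decreasing assembled
      in Encoded-≡ (sym a≡arm) (sym (cong₂ _,_ t≡above (cong₂ _,_ md≡leg b≡below)))
      where
      open IsHookPartition (IsHookPartition-sound {m} {suc k₀} {suc s′} {N} (proj₁ (from e)) (proj₂ (from e)))
      open Decomposition (decompose (proj₁ (from e)) decreasing positive reaches-column)

  Summand : ℕ → ℕ → Set
  Summand a = Shift (frame a) (DecreasingSequences s′ ⋆ (BoxPartitions (k₀ ∸ a) a ⋆ BoundedPartitions m′))

  Pieces↔Summand : ∀ a N → OfWeight (Pieces a) (λ p → frame a ℕ.+ pieces-weight p) N ↔ Summand a N
  Pieces↔Summand a N = ↔-trans (OfWeight-shift (Pieces a) pieces-weight (frame a) N) (Shift-cong (frame a) (λ M →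
    ↔-trans (OfWeight-pair (DecreasingOfLength s′) (InBox (k₀ ∸ a) a ⟨×⟩ BoundedPartition m′) sum (λ (md , b) → sum md ℕ.+ sum b) M)
            (⋆-congʳ (DecreasingSequences s′) (OfWeight-pair (InBox (k₀ ∸ a) a) (BoundedPartition m′) sum sum) M)) N)

  HookPartitions↔Σ≤ : ∀ N → HookPartitions m (suc k₀) (suc s′) N ↔ Σ≤ k₀ (λ a → Summand a N)
  HookPartitions↔Σ≤ N = ↔-trans (HookPartitions↔Encoded N) (Σ≤-cong k₀ (λ a → Pieces↔Summand a N))

  counted-Summand : ∀ a → Counted (Summand a)
  counted-Summand a = counted-Shift (frame a)
    (counted-⋆ (counted-DecreasingSequences s′) (counted-⋆ (counted-BoxPartitions (k₀ ∸ a) a) (counted-BoundedPartitions m′)))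

  counted-HookPartitions : Counted (HookPartitions m (suc k₀) (suc s′))
  counted-HookPartitions N = finite-↔ (finite-Σ≤ k₀ (λ a → Summand a N) (λ a → counted-Summand a N)) (↔-sym (HookPartitions↔Σ≤ N))

  gf-Summand : ∀ a → a ≤ k₀ → ((qPow (frame a) ⊛ inv (qPoch s′ ⊛ qPoch m′)) ⊛ qBinom k₀ a) ≗ gf (counted-Summand a)
  gf-Summand a a≤k₀ = begin
    (qPow (frame a) ⊛ inv (qPoch s′ ⊛ qPoch m′)) ⊛ qBinom k₀ a
      ≡⟨ cong (λ n → (qPow (frame a) ⊛ inv (qPoch s′ ⊛ qPoch m′)) ⊛ qBinom n a) (ℕP.m∸n+n≡m a≤k₀) ⟨
    (qPow (frame a) ⊛ inv (qPoch s′ ⊛ qPoch m′)) ⊛ qBinom (k₀ ∸ a ℕ.+ a) a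
      ≈⟨ S.*-cong (⊛-congˡ (qPow (frame a)) inv-qPoch-qPoch) (gf-BoxPartitions (k₀ ∸ a) a) ⟩
    (qPow (frame a) ⊛ (Q ⊛ R)) ⊛ B
      ≈⟨ solve 4 (λ e q r b → (e :* (q :* r)) :* b := e :* (q :* (b :* r))) (λ _ → refl) (qPow (frame a)) Q R B ⟩
    qPow (frame a) ⊛ (Q ⊛ (B ⊛ R))
      ≈⟨ ⊛-congˡ (qPow (frame a)) (S.trans (⊛-congˡ Q (S.sym (gf-⋆ fB fR))) (S.sym (gf-⋆ fQ (counted-⋆ fB fR)))) ⟩
    qPow (frame a) ⊛ gf (counted-⋆ fQ (counted-⋆ fB fR))
      ≈⟨ gf-Shift (frame a) (counted-⋆ fQ (counted-⋆ fB fR)) ⟨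
    gf (counted-Summand a)
      ∎
    where
    open import Relation.Binary.Reasoning.Setoid S.setoid
    fQ = counted-DecreasingSequences s′
    fB = counted-BoxPartitions (k₀ ∸ a) a
    fR = counted-BoundedPartitions m′
    Q B R : Series
    Q = gf fQ
    B = gf fB
    R = gf fR
    inv-qPoch-qPoch : inv (qPoch s′ ⊛ qPoch m′) ≗ (Q ⊛ R)
    inv-qPoch-qPoch = S.trans (inv-⊛ (qPoch s′) (qPoch m′) (qPoch-constant s′) (qPoch-constant m′))
                              (S.*-cong (gf-DecreasingSequences s′) (gf-BoundedPartitions m′))

  card-HookPartitions : ∀ N →
    + card (counted-HookPartitions N) ≡ sumTo k₀ (λ a → ((qPow (frame a) ⊛ inv (qPoch s′ ⊛ qPoch m′)) ⊛ qBinom k₀ a) N)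
  card-HookPartitions N = trans (card-Σ≤ k₀ (λ a → Summand a N) (λ a → counted-Summand a N))
                                (sumTo-cong k₀ (λ a a≤k₀ → sym (gf-Summand a a≤k₀ N)))

sumSeries1-sumTo : ∀ k₀ F N → sumSeries1 (suc k₀) F N ≡ sumTo k₀ (λ a → F (suc a) N)
sumSeries1-sumTo zero F N = ℤP.+-identityˡ (F 1 N)
sumSeries1-sumTo (suc k₀) F N = cong (ℤ._+ F (suc (suc k₀)) N) (sumSeries1-sumTo k₀ F N)

hookGF-exponent : ℤ → ℤ → ℤ → ℤ → ℤ
hookGF-exponent m k h l = (m ℤ.- + 1) ℤ.* (+ 2 ℤ.* k ℤ.- h ℤ.- l) ℤ.+ k ℤ.+ l ℤ.* (k ℤ.- h ℤ.- + 1)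

pos-suc : ∀ n → + suc n ≡ + 1 ℤ.+ + n
pos-suc = ℤP.pos-+ 1

pos-frame : ∀ m′ L a s′ →
  + (suc s′ ℕ.* (suc m′ ℕ.+ a) ℕ.+ L ℕ.* suc m′) ≡ (+ 1 ℤ.+ + s′) ℤ.* ((+ 1 ℤ.+ + m′) ℤ.+ + a) ℤ.+ + L ℤ.* (+ 1 ℤ.+ + m′)
pos-frame m′ L a s′ = begin
  + (suc s′ ℕ.* (suc m′ ℕ.+ a) ℕ.+ L ℕ.* suc m′)
    ≡⟨ ℤP.pos-+ (suc s′ ℕ.* (suc m′ ℕ.+ a)) (L ℕ.* suc m′) ⟩
  + (suc s′ ℕ.* (suc m′ ℕ.+ a)) ℤ.+ + (L ℕ.* suc m′)
    ≡⟨ cong₂ ℤ._+_ (ℤP.pos-* (suc s′) (suc m′ ℕ.+ a)) (ℤP.pos-* L (suc m′)) ⟩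
  + suc s′ ℤ.* + (suc m′ ℕ.+ a) ℤ.+ + L ℤ.* + suc m′
    ≡⟨ cong₂ (λ S M+a → S ℤ.* M+a ℤ.+ + L ℤ.* + suc m′) (pos-suc s′) (trans (ℤP.pos-+ (suc m′) a) (cong (ℤ._+ + a) (pos-suc m′))) ⟩
  (+ 1 ℤ.+ + s′) ℤ.* ((+ 1 ℤ.+ + m′) ℤ.+ + a) ℤ.+ + L ℤ.* + suc m′
    ≡⟨ cong (λ M → (+ 1 ℤ.+ + s′) ℤ.* ((+ 1 ℤ.+ + m′) ℤ.+ + a) ℤ.+ + L ℤ.* M) (pos-suc m′) ⟩
  (+ 1 ℤ.+ + s′) ℤ.* ((+ 1 ℤ.+ + m′) ℤ.+ + a) ℤ.+ + L ℤ.* (+ 1 ℤ.+ + m′)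
    ∎
  where open ≡-Reasoning

hookGF-exponent≡frame : ∀ m′ L a s′ (h : ℤ) → + s′ ≡ + suc (L ℕ.+ a) ℤ.- h ℤ.- + 1 →
  hookGF-exponent (+ suc m′) (+ suc (L ℕ.+ a)) h (+ suc a) ≡ + (suc s′ ℕ.* (suc m′ ℕ.+ a) ℕ.+ L ℕ.* suc m′)
hookGF-exponent≡frame m′ L a s′ h s′≡k-h-1 = begin
  hookGF-exponent (+ suc m′) K h (+ suc a)
    ≡⟨ cong (hookGF-exponent (+ suc m′) K h) (pos-suc a) ⟩
  hookGF-exponent (+ suc m′) K h (+ 1 ℤ.+ + a)
    ≡⟨ cong (λ h → hookGF-exponent (+ suc m′) K h (+ 1 ℤ.+ + a)) h≡k-1-s′ ⟩
  hookGF-exponent (+ suc m′) K (K ℤ.- + 1 ℤ.- + s′) (+ 1 ℤ.+ + a)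
    ≡⟨ cong₂ (λ M K → hookGF-exponent M K (K ℤ.- + 1 ℤ.- + s′) (+ 1 ℤ.+ + a)) (pos-suc m′) K≡1+L+a ⟩
  hookGF-exponent (+ 1 ℤ.+ + m′) (+ 1 ℤ.+ (+ L ℤ.+ + a)) (+ 1 ℤ.+ (+ L ℤ.+ + a) ℤ.- + 1 ℤ.- + s′) (+ 1 ℤ.+ + a)
    ≡⟨ identity (+ m′) (+ L) (+ a) (+ s′) ⟩
  (+ 1 ℤ.+ + s′) ℤ.* ((+ 1 ℤ.+ + m′) ℤ.+ + a) ℤ.+ + L ℤ.* (+ 1 ℤ.+ + m′)
    ≡⟨ pos-frame m′ L a s′ ⟨
  + (suc s′ ℕ.* (suc m′ ℕ.+ a) ℕ.+ L ℕ.* suc m′)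
    ∎
  where
  open ≡-Reasoning
  K : ℤ
  K = + suc (L ℕ.+ a)
  K≡1+L+a : K ≡ + 1 ℤ.+ (+ L ℤ.+ + a)
  K≡1+L+a = trans (pos-suc (L ℕ.+ a)) (cong (λ x → + 1 ℤ.+ x) (ℤP.pos-+ L a))
  h≡k-1-s′ : h ≡ K ℤ.- + 1 ℤ.- + s′
  h≡k-1-s′ = trans (solve-h K h) (cong (λ S → K ℤ.- + 1 ℤ.- S) (sym s′≡k-h-1))
    where
    solve-h : ∀ K H → H ≡ K ℤ.- + 1 ℤ.- (K ℤ.- H ℤ.- + 1)
    solve-h = Z.solve-∀
  identity : ∀ M L A S →
    ((+ 1 ℤ.+ M) ℤ.- + 1) ℤ.* (+ 2 ℤ.* (+ 1 ℤ.+ (L ℤ.+ A)) ℤ.- (+ 1 ℤ.+ (L ℤ.+ A) ℤ.- + 1 ℤ.- S) ℤ.- (+ 1 ℤ.+ A))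
      ℤ.+ (+ 1 ℤ.+ (L ℤ.+ A)) ℤ.+ (+ 1 ℤ.+ A) ℤ.* ((+ 1 ℤ.+ (L ℤ.+ A)) ℤ.- (+ 1 ℤ.+ (L ℤ.+ A) ℤ.- + 1 ℤ.- S) ℤ.- + 1)
    ≡ (+ 1 ℤ.+ S) ℤ.* ((+ 1 ℤ.+ M) ℤ.+ A) ℤ.+ L ℤ.* (+ 1 ℤ.+ M)
  identity = Z.solve-∀

∣hookGF-exponent∣≡frame : ∀ m′ k₀ a s′ (h : ℤ) → a ≤ k₀ → + s′ ≡ + suc k₀ ℤ.- h ℤ.- + 1 →
  ∣ hookGF-exponent (+ suc m′) (+ suc k₀) h (+ suc a) ∣ ≡ HookCount.frame m′ s′ k₀ a
∣hookGF-exponent∣≡frame m′ k₀ a s′ h a≤k₀ s′≡k-h-1 = cong ∣_∣ (subst at-k₀ (ℕP.m∸n+n≡m a≤k₀)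
  (hookGF-exponent≡frame m′ (k₀ ∸ a) a s′ h (trans s′≡k-h-1 (cong (λ k → + suc k ℤ.- h ℤ.- + 1) (sym (ℕP.m∸n+n≡m a≤k₀))))))
  where
  at-k₀ : ℕ → Set
  at-k₀ k = hookGF-exponent (+ suc m′) (+ suc k) h (+ suc a) ≡ + (suc s′ ℕ.* (suc m′ ℕ.+ a) ℕ.+ (k₀ ∸ a) ℕ.* suc m′)

+∣k-h-1∣≡k-h-1 : ∀ k (h : ℤ) → h ℤ.≤ + k ℤ.- + 1 → + ∣ + k ℤ.- h ℤ.- + 1 ∣ ≡ + k ℤ.- h ℤ.- + 1
+∣k-h-1∣≡k-h-1 k h h≤k-1 = ℤP.0≤i⇒+∣i∣≡i (subst (ℤ.+0 ℤ.≤_) (reorder (+ k) h) (ℤP.i≤j⇒0≤j-i h≤k-1))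
  where
  reorder : ∀ K H → K ℤ.- + 1 ℤ.- H ≡ K ℤ.- H ℤ.- + 1
  reorder = Z.solve-∀

∣k-h∣≡1+∣k-h-1∣ : ∀ k (h : ℤ) → h ℤ.≤ + k ℤ.- + 1 → ∣ + k ℤ.- h ∣ ≡ suc ∣ + k ℤ.- h ℤ.- + 1 ∣
∣k-h∣≡1+∣k-h-1∣ k h h≤k-1 = cong ∣_∣ (begin
  + k ℤ.- h                                 ≡⟨ split (+ k) h ⟩
  + 1 ℤ.+ (+ k ℤ.- h ℤ.- + 1)               ≡⟨ cong (λ x → + 1 ℤ.+ x) (+∣k-h-1∣≡k-h-1 k h h≤k-1) ⟨
  + 1 ℤ.+ + ∣ + k ℤ.- h ℤ.- + 1 ∣           ≡⟨ pos-suc _ ⟨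
  + suc ∣ + k ℤ.- h ℤ.- + 1 ∣               ∎)
  where
  open ≡-Reasoning
  split : ∀ K H → K ℤ.- H ≡ + 1 ℤ.+ (K ℤ.- H ℤ.- + 1)
  split = Z.solve-∀

theorem3p2 : (m k : ℕ) (h : ℤ) → 1 ≤ m → 1 ≤ k → h ℤ.≤ (+ k) ℤ.- (+ 1) →
    (n : ℕ) → Σ ℕ (λ c → (Fin c ↔ HookPartitions m k ∣ (+ k) ℤ.- h ∣ n) × (hookGF m k h n ≡ + c))
theorem3p2 (suc m′) (suc k₀) h _ _ h≤k-1 n =
  card (counted-HookPartitions n) ,
  subst (λ s → Fin (card (counted-HookPartitions n)) ↔ HookPartitions (suc m′) (suc k₀) s n)
        (sym (∣k-h∣≡1+∣k-h-1∣ (suc k₀) h h≤k-1)) (proj₂ (counted-HookPartitions n)) ,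
  (begin
    hookGF (suc m′) (suc k₀) h n
      ≡⟨ sumSeries1-sumTo k₀ _ n ⟩
    sumTo k₀ (λ a → ((qPow (exponent a) ⊛ inv (qPoch s′ ⊛ qPoch m′)) ⊛ qBinom k₀ a) n)
      ≡⟨ sumTo-cong k₀ (λ a a≤k₀ → cong (λ e → ((qPow e ⊛ inv (qPoch s′ ⊛ qPoch m′)) ⊛ qBinom k₀ a) n)
           (∣hookGF-exponent∣≡frame m′ k₀ a s′ h a≤k₀ (+∣k-h-1∣≡k-h-1 (suc k₀) h h≤k-1))) ⟩
    sumTo k₀ (λ a → ((qPow (frame a) ⊛ inv (qPoch s′ ⊛ qPoch m′)) ⊛ qBinom k₀ a) n)
      ≡⟨ card-HookPartitions n ⟨
    + card (counted-HookPartitions n)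
      ∎)
  where
  open ≡-Reasoning
  s′ : ℕ
  s′ = ∣ + suc k₀ ℤ.- h ℤ.- + 1 ∣
  open HookCount m′ s′ k₀
  exponent : ℕ → ℕ
  exponent a = ∣ hookGF-exponent (+ suc m′) (+ suc k₀) h (+ suc a) ∣
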